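{- Let $K_n=(V,E)$ be the complete graph with $|V|=n\ge 2$, and let $X$ be a cut of cardinality $k$. Then the degree of the vertex $K^{+}_{\min}(X)$ in the graph of the cone partition for the min-cut problem with non-negative edges equals $2^{n-k}+2^{k}-4$.
   Context: Let $d=\binom{n}{2}=|E|$. For $S\subseteq V$, the cut vector $\mathbf{v}(S)\in\{0,1\}^{d}$ has coordinates indexed by edges $\{i,j\}\in E$, with $\mathbf{v}(S)_{i,j}=1$ if $|S\cap\{i,j\}|=1$ and $0$ otherwise. A cut is a nonempty proper subset $X\subset V$, where $X$ and its complement $V\setminus X$ are identified; the empty cut is excluded, so there are $2^{n-1}-1$ cuts. The cardinality of a cut $S$ is $\min(|S|,|V\setminus S|)$. For a cut $X$, $K^{+}_{\min}(X)=\{\mathbf{c}\in\mathbb{R}^{d}:\ \mathbf{c}\ge\mathbf{0},\ \langle\mathbf{c},\mathbf{v}(X)\rangle\le\langle\mathbf{c},\mathbf{v}(Y)\rangle \text{ for all cuts } Y\}$. Two cones $K^{+}_{\min}(X),K^{+}_{\min}(Y)$ with $X\ne Y$ are adjacent if $\dim\big(K^{+}_{\min}(X)\cap K^{+}_{\min}(Y)\big)=d-1$. The graph of the cone partition has one vertex per cut and an edge between two cones iff they are adjacent; the degree of a vertex is its number of neighbours in this graph.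
   Formalization: The cones $K^{+}_{\min}(X)$ are taken in ℚ^d rather than ℝ^d, so the dimensions deciding adjacency are computed over the rationals. -}

module Defs where

open import Data.Nat as ℕ using (ℕ; zero; suc; _∸_; _⊓_)
open import Data.Nat.Combinatorics using (_C_)
open import Data.Fin as Fin using (Fin; _<_; _<?_)
open import Data.Fin.Subset using (Subset; ∁; ∣_∣; Nonempty)
open import Data.Rational using (ℚ; 0ℚ; 1ℚ; _+_; _*_; _≤_)
open import Data.Bool using (Bool; true; false; if_then_else_; _xor_)
open import Data.Vec using (lookup)
open import Data.Product using (Σ; _×_; _,_; proj₁; proj₂)
open import Data.Sum using (_⊎_)
open import Data.List using (List; length)
open import Data.List.Relation.Unary.All using (All)
open import Data.List.Relation.Unary.Any using (Any)
open import Data.List.Relation.Unary.AllPairs using (AllPairs)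
open import Relation.Nullary using (¬_; yes; no)
open import Relation.Binary.PropositionalEquality using (_≡_)

Edge : ℕ → Set
Edge n = Σ (Fin n × Fin n) (λ e → proj₁ e < proj₂ e)

-- Vectors in ℚ^E (coordinates indexed by edges); d = n C 2 = |E|.
Vect : ℕ → Set
Vect n = Edge n → ℚ

sumFin : ∀ {m} → (Fin m → ℚ) → ℚ
sumFin {zero} f = 0ℚ
sumFin {suc m} f = f Fin.zero + sumFin (λ i → f (Fin.suc i))

cutVec : ∀ {n} → Subset n → Vect n
cutVec S ((i , j) , _) = if (lookup S i xor lookup S j) then 1ℚ else 0ℚ

edgeTerm : ∀ {n} → Vect n → Vect n → Fin n → Fin n → ℚ
edgeTerm c v i j with i <? j
... | yes p = c ((i , j) , p) * v ((i , j) , p)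
... | no _ = 0ℚ

⟨_,_⟩ : ∀ {n} → Vect n → Vect n → ℚ
⟨ c , v ⟩ = sumFin (λ i → sumFin (λ j → edgeTerm c v i j))

-- a cut: nonempty proper subset (identification with complement via SameCut)
IsCut : ∀ {n} → Subset n → Set
IsCut S = Nonempty S × Nonempty (∁ S)

SameCut : ∀ {n} → Subset n → Subset n → Set
SameCut X Y = (X ≡ Y) ⊎ (X ≡ ∁ Y)

cutCard : ∀ {n} → Subset n → ℕ
cutCard {n} S = ∣ S ∣ ⊓ (n ∸ ∣ S ∣)

Kmin : ∀ {n} → Subset n → Vect n → Set
Kmin X c = (∀ e → 0ℚ ≤ c e) × (∀ Y → IsCut Y → ⟨ c , cutVec X ⟩ ≤ ⟨ c , cutVec Y ⟩)

LinIndep : ∀ {n m} → (Fin m → Vect n) → Set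
LinIndep {n} {m} v =
  (a : Fin m → ℚ) → (∀ e → sumFin (λ i → a i * v i e) ≡ 0ℚ) → ∀ i → a i ≡ 0ℚ

-- C contains m linearly independent vectors (dim of linear span ≥ m)
DimAtLeast : ∀ {n} → (Vect n → Set) → ℕ → Set
DimAtLeast {n} K m = Σ (Fin m → Vect n) (λ v → LinIndep v × (∀ i → K (v i)))

DimEq : ∀ {n} → (Vect n → Set) → ℕ → Set
DimEq K m = DimAtLeast K m × ¬ DimAtLeast K (suc m)

Adjacent : ∀ {n} → Subset n → Subset n → Set
Adjacent {n} X Y =
  ¬ SameCut X Y × DimEq (λ c → Kmin X c × Kmin Y c) ((n C 2) ∸ 1)

-- L is a list of representatives, one per cut class, of exactly the cuts adjacent to X
NeighbourList : ∀ {n} → Subset n → List (Subset n) → Set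
NeighbourList X L =
  All (λ Y → IsCut Y × Adjacent X Y) L
  × AllPairs (λ A B → ¬ SameCut A B) L
  × (∀ Y → IsCut Y → Adjacent X Y → Any (SameCut Y) L)

Degree : ∀ {n} → Subset n → ℕ → Set
Degree {n} X m = Σ (List (Subset n)) (λ L → NeighbourList X L × length L ≡ m)

module Submission where

-- The cones of X and Y are adjacent exactly when Y is nested with X, i.e. a side of Y is a
-- nonempty proper subset of X or of V ∖ X; there are (2^|X| - 2) + (2^(n-|X|) - 2) such cuts.
-- If all four quadrants X ∩ Y, X ∖ Y, Y ∖ X, V ∖ (X ∪ Y) are nonempty, the uncrossing identity
-- v(X) + v(Y) = v(X ∩ Y) + v(X ∪ Y) + 2·[edges between X ∖ Y and Y ∖ X], applied to (X, Y) and
-- to (X, V ∖ Y), shows that every c in both cones vanishes on two fixed edges: the cones meet in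
-- dimension at most d - 2. If Y is nested with X, V splits into three nonempty parts; the cones
-- meet inside the hyperplane ⟨c, v(X)⟩ = ⟨c, v(Y)⟩, and d - 1 of the unit vectors, corrected to
-- lie in both cones, stay linearly independent because they are triangular.

open import Defs

open import Data.Nat as ℕ using (ℕ; zero; suc; s≤s; z≤n; _∸_; _^_)
open import Data.Bool using (Bool; true; false; not; _∧_; _∨_; _xor_; if_then_else_)
open import Data.Fin as Fin using (Fin)
open import Data.Fin.Subset using (Subset; inside; outside; ∁; _∩_; _∪_; _∈_; _∉_; _⊆_; _⊂_; Nonempty; Empty; ∣_∣)
open import Data.Product using (∃; ∃₂; _×_; _,_; proj₁; proj₂; map₂)
open import Data.Sum as Sum using (_⊎_; inj₁; inj₂)
open import Function using (_∘_)
open import Function.Bundles using (_↔_)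
open import Relation.Nullary using (¬_; Dec; yes; no; ¬?; does; contradiction)
open import Relation.Binary using (DecidableEquality)
open import Relation.Binary.PropositionalEquality

module Vectors where
  open import Data.Nat.Properties using (m<n⇒m<1+n; n<1+n; <-≤-trans)
  open import Data.Nat.Combinatorics using (_C_; nC1≡n; nCk+nC[k+1]≡[n+1]C[k+1])
  open import Data.Fin using (punchIn; punchOut; _<?_)
  open import Data.Fin.Properties
    using (suc-injective; <-irrelevant; <-cmp; _≟_; splitAt-↑ˡ; splitAt-↑ʳ; splitAt⁻¹-↑ˡ; splitAt⁻¹-↑ʳ;
           any?; punchIn-punchOut; punchInᵢ≢i; punchIn-injective)
  open import Data.Product.Properties using (≡-dec)
  open import Data.Rational as ℚ using (ℚ; 0ℚ; 1ℚ; _+_; _*_; _≤_; -_; 1/_)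
  import Data.Rational.Properties as ℚₚ
  open import Data.Vec.Functional using (insertAt)
  open import Data.Vec.Functional.Properties using (insertAt-lookup; insertAt-punchIn)
  open import Function.Bundles using (Inverse; Injection; mk↔ₛ′)
  open import Function.Properties.Inverse using (Inverse⇒Injection)
  open import Relation.Binary using (tri<; tri≈; tri>)
  open import Data.Rational.Solver using (module +-*-Solver)
  open +-*-Solver using (solve; _:+_; _:*_; :-_; _:=_; con)

  sumFin-cong : ∀ {m} {f g : Fin m → ℚ} → (∀ i → f i ≡ g i) → sumFin f ≡ sumFin g
  sumFin-cong {zero}  f≗g = refl
  sumFin-cong {suc m} f≗g = cong₂ _+_ (f≗g Fin.zero) (sumFin-cong (f≗g ∘ Fin.suc))

  sumFin-zero : ∀ {m} {f : Fin m → ℚ} → (∀ i → f i ≡ 0ℚ) → sumFin f ≡ 0ℚ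
  sumFin-zero {zero}  f≗0 = refl
  sumFin-zero {suc m} f≗0 = cong₂ _+_ (f≗0 Fin.zero) (sumFin-zero (f≗0 ∘ Fin.suc))

  sumFin-+ : ∀ {m} (f g : Fin m → ℚ) → sumFin (λ i → f i + g i) ≡ sumFin f + sumFin g
  sumFin-+ {zero}  f g = refl
  sumFin-+ {suc m} f g = begin
    (f₀ + g₀) + sumFin (λ i → f (Fin.suc i) + g (Fin.suc i))
      ≡⟨ cong ((f₀ + g₀) +_) (sumFin-+ (f ∘ Fin.suc) (g ∘ Fin.suc)) ⟩
    (f₀ + g₀) + (sumFin (f ∘ Fin.suc) + sumFin (g ∘ Fin.suc))
      ≡⟨ solve 4 (λ a b c d → (a :+ b) :+ (c :+ d) := (a :+ c) :+ (b :+ d)) refl f₀ g₀ _ _ ⟩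
    (f₀ + sumFin (f ∘ Fin.suc)) + (g₀ + sumFin (g ∘ Fin.suc)) ∎
    where
    open ≡-Reasoning
    f₀ = f Fin.zero
    g₀ = g Fin.zero

  sumFin-*ˡ : ∀ {m} q (f : Fin m → ℚ) → sumFin (λ i → q * f i) ≡ q * sumFin f
  sumFin-*ˡ {zero}  q f = sym (ℚₚ.*-zeroʳ q)
  sumFin-*ˡ {suc m} q f =
    trans (cong (q * f Fin.zero +_) (sumFin-*ˡ q (f ∘ Fin.suc))) (sym (ℚₚ.*-distribˡ-+ q _ _))

  sumFin-single : ∀ {m} (f : Fin m → ℚ) i → (∀ j → j ≢ i → f j ≡ 0ℚ) → sumFin f ≡ f i
  sumFin-single {suc m} f Fin.zero f≗0 =
    trans (cong (f Fin.zero +_) (sumFin-zero (λ j → f≗0 (Fin.suc j) λ ()))) (ℚₚ.+-identityʳ _)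
  sumFin-single {suc m} f (Fin.suc i) f≗0 =
    trans (cong₂ _+_ (f≗0 Fin.zero λ ()) (sumFin-single (f ∘ Fin.suc) i λ j j≢i → f≗0 (Fin.suc j) (j≢i ∘ suc-injective)))
          (ℚₚ.+-identityˡ _)

  sumFin-nonneg : ∀ {m} {f : Fin m → ℚ} → (∀ i → 0ℚ ≤ f i) → 0ℚ ≤ sumFin f
  sumFin-nonneg {zero}  f≥0 = ℚₚ.≤-refl
  sumFin-nonneg {suc m} f≥0 = ℚₚ.+-mono-≤ (f≥0 Fin.zero) (sumFin-nonneg (f≥0 ∘ Fin.suc))

  ≤-+ʳ : ∀ {p q} → 0ℚ ≤ q → p ≤ p + q
  ≤-+ʳ {p} {q} q≥0 = subst (_≤ p + q) (ℚₚ.+-identityʳ p) (ℚₚ.+-monoʳ-≤ p q≥0)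

  ≤-+ˡ : ∀ {p q} → 0ℚ ≤ p → q ≤ p + q
  ≤-+ˡ {p} {q} p≥0 = subst (_≤ p + q) (ℚₚ.+-identityˡ q) (ℚₚ.+-monoˡ-≤ q p≥0)

  term≤sumFin : ∀ {m} {f : Fin m → ℚ} → (∀ i → 0ℚ ≤ f i) → ∀ i → f i ≤ sumFin f
  term≤sumFin {suc m} f≥0 Fin.zero    = ≤-+ʳ (sumFin-nonneg (f≥0 ∘ Fin.suc))
  term≤sumFin {suc m} f≥0 (Fin.suc i) =
    ℚₚ.≤-trans (term≤sumFin (f≥0 ∘ Fin.suc) i) (≤-+ˡ (f≥0 Fin.zero))

  sumFin-punchIn : ∀ {m} (f : Fin (suc m) → ℚ) j → sumFin f ≡ f j + sumFin (f ∘ punchIn j)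
  sumFin-punchIn         f Fin.zero    = refl
  sumFin-punchIn {suc m} f (Fin.suc j) =
    trans (cong (f Fin.zero +_) (sumFin-punchIn (f ∘ Fin.suc) j))
          (solve 3 (λ a b c → a :+ (b :+ c) := b :+ (a :+ c)) refl (f Fin.zero) (f (Fin.suc j)) _)

  sumFin-swap : ∀ {m k} (f : Fin m → Fin k → ℚ) →
    sumFin (λ i → sumFin (f i)) ≡ sumFin (λ j → sumFin (λ i → f i j))
  sumFin-swap {zero} {k} f = sym (sumFin-zero {k} λ _ → refl)
  sumFin-swap {suc m} f =
    trans (cong (sumFin (f Fin.zero) +_) (sumFin-swap (f ∘ Fin.suc)))
          (sym (sumFin-+ (f Fin.zero) (λ j → sumFin (λ i → f (Fin.suc i) j))))

  infixl 6 _⊕_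
  infixl 7 _∙_

  _⊕_ : ∀ {n} → Vect n → Vect n → Vect n
  (c ⊕ c′) e = c e + c′ e

  _∙_ : ∀ {n} → ℚ → Vect n → Vect n
  (q ∙ c) e = q * c e

  combination : ∀ {n m} → (Fin m → ℚ) → (Fin m → Vect n) → Vect n
  combination a v e = sumFin (λ i → a i * v i e)

  onPair : ∀ {n} → (Edge n → ℚ) → Fin n → Fin n → ℚ
  onPair h i j with i <? j
  ... | yes i<j = h ((i , j) , i<j)
  ... | no  _   = 0ℚ

  edgeSum : ∀ {n} → (Edge n → ℚ) → ℚ
  edgeSum h = sumFin (λ i → sumFin (onPair h i))

  onPair-cong : ∀ {n} {h g : Edge n → ℚ} → (∀ e → h e ≡ g e) → ∀ i j → onPair h i j ≡ onPair g i j
  onPair-cong h≗g i j with i <? j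
  ... | yes _ = h≗g _
  ... | no  _ = refl

  onPair-+ : ∀ {n} (h g : Edge n → ℚ) i j → onPair (λ e → h e + g e) i j ≡ onPair h i j + onPair g i j
  onPair-+ h g i j with i <? j
  ... | yes _ = refl
  ... | no  _ = refl

  onPair-*ˡ : ∀ {n} q (h : Edge n → ℚ) i j → onPair (λ e → q * h e) i j ≡ q * onPair h i j
  onPair-*ˡ q h i j with i <? j
  ... | yes _ = refl
  ... | no  _ = sym (ℚₚ.*-zeroʳ q)

  onPair-sumFin : ∀ {n m} (g : Fin m → Edge n → ℚ) i j →
    onPair (λ e → sumFin (λ k → g k e)) i j ≡ sumFin (λ k → onPair (g k) i j)
  onPair-sumFin {m = m} g i j with i <? j
  ... | yes _ = refl
  ... | no  _ = sym (sumFin-zero {m} λ _ → refl)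

  onPair-nonneg : ∀ {n} {h : Edge n → ℚ} → (∀ e → 0ℚ ≤ h e) → ∀ i j → 0ℚ ≤ onPair h i j
  onPair-nonneg h≥0 i j with i <? j
  ... | yes _ = h≥0 _
  ... | no  _ = ℚₚ.≤-refl

  onPair-edge : ∀ {n} (h : Edge n → ℚ) i j (i<j : i Fin.< j) → onPair h i j ≡ h ((i , j) , i<j)
  onPair-edge h i j i<j with i <? j
  ... | yes i<j′ = cong (λ p → h ((i , j) , p)) (<-irrelevant i<j′ i<j)
  ... | no  i≮j  = contradiction i<j i≮j

  edgeSum-cong : ∀ {n} {h g : Edge n → ℚ} → (∀ e → h e ≡ g e) → edgeSum h ≡ edgeSum g
  edgeSum-cong h≗g = sumFin-cong λ i → sumFin-cong (onPair-cong h≗g i)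

  edgeSum-+ : ∀ {n} (h g : Edge n → ℚ) → edgeSum (λ e → h e + g e) ≡ edgeSum h + edgeSum g
  edgeSum-+ h g =
    trans (sumFin-cong λ i → trans (sumFin-cong (onPair-+ h g i)) (sumFin-+ (onPair h i) (onPair g i)))
          (sumFin-+ (λ i → sumFin (onPair h i)) (λ i → sumFin (onPair g i)))

  edgeSum-*ˡ : ∀ {n} q (h : Edge n → ℚ) → edgeSum (λ e → q * h e) ≡ q * edgeSum h
  edgeSum-*ˡ q h =
    trans (sumFin-cong λ i → trans (sumFin-cong (onPair-*ˡ q h i)) (sumFin-*ˡ q (onPair h i)))
          (sumFin-*ˡ q (λ i → sumFin (onPair h i)))

  edgeSum-sumFin : ∀ {n m} (g : Fin m → Edge n → ℚ) →
    edgeSum (λ e → sumFin (λ k → g k e)) ≡ sumFin (λ k → edgeSum (g k))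
  edgeSum-sumFin g =
    trans (sumFin-cong λ i → trans (sumFin-cong (onPair-sumFin g i)) (sumFin-swap λ j k → onPair (g k) i j))
          (sumFin-swap λ i k → sumFin (onPair (g k) i))

  edgeSum-nonneg : ∀ {n} {h : Edge n → ℚ} → (∀ e → 0ℚ ≤ h e) → 0ℚ ≤ edgeSum h
  edgeSum-nonneg h≥0 = sumFin-nonneg λ i → sumFin-nonneg (onPair-nonneg h≥0 i)

  term≤edgeSum : ∀ {n} {h : Edge n → ℚ} → (∀ e → 0ℚ ≤ h e) → ∀ e → h e ≤ edgeSum h
  term≤edgeSum {h = h} h≥0 ((i , j) , i<j) = begin
    h ((i , j) , i<j)        ≡⟨ onPair-edge h i j i<j ⟨
    onPair h i j             ≤⟨ term≤sumFin (onPair-nonneg h≥0 i) j ⟩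
    sumFin (onPair h i)      ≤⟨ term≤sumFin (λ i′ → sumFin-nonneg (onPair-nonneg h≥0 i′)) i ⟩
    edgeSum h                ∎
    where open ℚₚ.≤-Reasoning

  edgeSum-single : ∀ {n} (h : Edge n → ℚ) e → (∀ f → f ≢ e → h f ≡ 0ℚ) → edgeSum h ≡ h e
  edgeSum-single h ((i , j) , i<j) h≗0 =
    trans (sumFin-single _ i rowZero) (trans (sumFin-single _ j colZero) (onPair-edge h i j i<j))
    where
    rowZero : ∀ i′ → i′ ≢ i → sumFin (onPair h i′) ≡ 0ℚ
    rowZero i′ i′≢i = sumFin-zero pairZero
      where
      pairZero : ∀ j′ → onPair h i′ j′ ≡ 0ℚ
      pairZero j′ with i′ <? j′
      ... | yes _ = h≗0 _ (i′≢i ∘ cong (proj₁ ∘ proj₁))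
      ... | no  _ = refl
    colZero : ∀ j′ → j′ ≢ j → onPair h i j′ ≡ 0ℚ
    colZero j′ j′≢j with i <? j′
    ... | yes _ = h≗0 _ (j′≢j ∘ cong (proj₂ ∘ proj₁))
    ... | no  _ = refl

  ⟨⟩≡edgeSum : ∀ {n} (c v : Vect n) → ⟨ c , v ⟩ ≡ edgeSum (λ e → c e * v e)
  ⟨⟩≡edgeSum c v = sumFin-cong λ i → sumFin-cong (termIsOnPair i)
    where
    termIsOnPair : ∀ i j → edgeTerm c v i j ≡ onPair (λ e → c e * v e) i j
    termIsOnPair i j with i <? j
    ... | yes _ = refl
    ... | no  _ = refl

  ⟨⟩-congʳ : ∀ {n} (c : Vect n) {v w : Vect n} → (∀ e → v e ≡ w e) → ⟨ c , v ⟩ ≡ ⟨ c , w ⟩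
  ⟨⟩-congʳ c {v} {w} v≗w = begin
    ⟨ c , v ⟩                     ≡⟨ ⟨⟩≡edgeSum c v ⟩
    edgeSum (λ e → c e * v e)     ≡⟨ edgeSum-cong (λ e → cong (c e *_) (v≗w e)) ⟩
    edgeSum (λ e → c e * w e)     ≡⟨ ⟨⟩≡edgeSum c w ⟨
    ⟨ c , w ⟩                     ∎
    where open ≡-Reasoning

  ⟨⊕⟩ˡ : ∀ {n} (c c′ w : Vect n) → ⟨ c ⊕ c′ , w ⟩ ≡ ⟨ c , w ⟩ + ⟨ c′ , w ⟩
  ⟨⊕⟩ˡ c c′ w = begin
    ⟨ c ⊕ c′ , w ⟩                                      ≡⟨ ⟨⟩≡edgeSum (c ⊕ c′) w ⟩
    edgeSum (λ e → (c e + c′ e) * w e)                  ≡⟨ edgeSum-cong (λ e → ℚₚ.*-distribʳ-+ (w e) (c e) (c′ e)) ⟩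
    edgeSum (λ e → c e * w e + c′ e * w e)              ≡⟨ edgeSum-+ (λ e → c e * w e) (λ e → c′ e * w e) ⟩
    edgeSum (λ e → c e * w e) + edgeSum (λ e → c′ e * w e) ≡⟨ cong₂ _+_ (⟨⟩≡edgeSum c w) (⟨⟩≡edgeSum c′ w) ⟨
    ⟨ c , w ⟩ + ⟨ c′ , w ⟩                              ∎
    where open ≡-Reasoning

  ⟨⊕⟩ʳ : ∀ {n} (c v w : Vect n) → ⟨ c , v ⊕ w ⟩ ≡ ⟨ c , v ⟩ + ⟨ c , w ⟩
  ⟨⊕⟩ʳ c v w = begin
    ⟨ c , v ⊕ w ⟩                                       ≡⟨ ⟨⟩≡edgeSum c (v ⊕ w) ⟩
    edgeSum (λ e → c e * (v e + w e))                   ≡⟨ edgeSum-cong (λ e → ℚₚ.*-distribˡ-+ (c e) (v e) (w e)) ⟩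
    edgeSum (λ e → c e * v e + c e * w e)               ≡⟨ edgeSum-+ (λ e → c e * v e) (λ e → c e * w e) ⟩
    edgeSum (λ e → c e * v e) + edgeSum (λ e → c e * w e) ≡⟨ cong₂ _+_ (⟨⟩≡edgeSum c v) (⟨⟩≡edgeSum c w) ⟨
    ⟨ c , v ⟩ + ⟨ c , w ⟩                               ∎
    where open ≡-Reasoning

  ⟨∙⟩ˡ : ∀ {n} q (c w : Vect n) → ⟨ q ∙ c , w ⟩ ≡ q * ⟨ c , w ⟩
  ⟨∙⟩ˡ q c w = begin
    ⟨ q ∙ c , w ⟩                    ≡⟨ ⟨⟩≡edgeSum (q ∙ c) w ⟩
    edgeSum (λ e → q * c e * w e)    ≡⟨ edgeSum-cong (λ e → ℚₚ.*-assoc q (c e) (w e)) ⟩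
    edgeSum (λ e → q * (c e * w e))  ≡⟨ edgeSum-*ˡ q (λ e → c e * w e) ⟩
    q * edgeSum (λ e → c e * w e)    ≡⟨ cong (q *_) (⟨⟩≡edgeSum c w) ⟨
    q * ⟨ c , w ⟩                    ∎
    where open ≡-Reasoning

  ⟨combination⟩ˡ : ∀ {n m} (a : Fin m → ℚ) (v : Fin m → Vect n) (w : Vect n) →
    ⟨ combination a v , w ⟩ ≡ sumFin (λ i → a i * ⟨ v i , w ⟩)
  ⟨combination⟩ˡ a v w = begin
    ⟨ combination a v , w ⟩                                 ≡⟨ ⟨⟩≡edgeSum (combination a v) w ⟩
    edgeSum (λ e → sumFin (λ i → a i * v i e) * w e)        ≡⟨ edgeSum-cong pull ⟩
    edgeSum (λ e → sumFin (λ i → a i * (v i e * w e)))      ≡⟨ edgeSum-sumFin (λ i e → a i * (v i e * w e)) ⟩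
    sumFin (λ i → edgeSum (λ e → a i * (v i e * w e)))      ≡⟨ sumFin-cong (λ i → edgeSum-*ˡ (a i) (λ e → v i e * w e)) ⟩
    sumFin (λ i → a i * edgeSum (λ e → v i e * w e))        ≡⟨ sumFin-cong (λ i → cong (a i *_) (⟨⟩≡edgeSum (v i) w)) ⟨
    sumFin (λ i → a i * ⟨ v i , w ⟩)                        ∎
    where
    open ≡-Reasoning
    pull : ∀ e → sumFin (λ i → a i * v i e) * w e ≡ sumFin (λ i → a i * (v i e * w e))
    pull e = begin
      sumFin (λ i → a i * v i e) * w e    ≡⟨ ℚₚ.*-comm _ (w e) ⟩
      w e * sumFin (λ i → a i * v i e)    ≡⟨ sumFin-*ˡ (w e) (λ i → a i * v i e) ⟨
      sumFin (λ i → w e * (a i * v i e))  ≡⟨ sumFin-cong (λ i → solve 3 (λ x y z → x :* (y :* z) := y :* (z :* x)) refl (w e) (a i) (v i e)) ⟩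
      sumFin (λ i → a i * (v i e * w e))  ∎

  NonNeg : ∀ {n} → Vect n → Set
  NonNeg c = ∀ e → 0ℚ ≤ c e

  *-nonneg : ∀ {p q} → 0ℚ ≤ p → 0ℚ ≤ q → 0ℚ ≤ p * q
  *-nonneg {p} {q} p≥0 q≥0 = ℚₚ.nonNegative⁻¹ (p * q)
    {{ℚₚ.nonNeg*nonNeg⇒nonNeg p {{ℚ.nonNegative p≥0}} q {{ℚ.nonNegative q≥0}}}}

  +-nonneg : ∀ {p q} → 0ℚ ≤ p → 0ℚ ≤ q → 0ℚ ≤ p + q
  +-nonneg = ℚₚ.+-mono-≤

  ⟨⟩-nonneg : ∀ {n} {c v : Vect n} → NonNeg c → NonNeg v → 0ℚ ≤ ⟨ c , v ⟩
  ⟨⟩-nonneg {c = c} {v} c≥0 v≥0 =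
    subst (0ℚ ≤_) (sym (⟨⟩≡edgeSum c v)) (edgeSum-nonneg λ e → *-nonneg (c≥0 e) (v≥0 e))

  term≤⟨⟩ : ∀ {n} {c v : Vect n} → NonNeg c → NonNeg v → ∀ e → c e * v e ≤ ⟨ c , v ⟩
  term≤⟨⟩ {c = c} {v} c≥0 v≥0 e =
    subst (c e * v e ≤_) (sym (⟨⟩≡edgeSum c v)) (term≤edgeSum (λ f → *-nonneg (c≥0 f) (v≥0 f)) e)

  ⟨⟩-zero : ∀ {n} (c v : Vect n) → (∀ e → c e * v e ≡ 0ℚ) → ⟨ c , v ⟩ ≡ 0ℚ
  ⟨⟩-zero {n} c v cv≗0 = begin
    ⟨ c , v ⟩                       ≡⟨ ⟨⟩≡edgeSum c v ⟩
    edgeSum (λ e → c e * v e)       ≡⟨ edgeSum-cong (λ e → trans (cv≗0 e) (sym (ℚₚ.*-zeroˡ 0ℚ))) ⟩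
    edgeSum {n} (λ _ → 0ℚ * 0ℚ)     ≡⟨ edgeSum-*ˡ {n} 0ℚ (λ _ → 0ℚ) ⟩
    0ℚ * edgeSum {n} (λ _ → 0ℚ)     ≡⟨ ℚₚ.*-zeroˡ (edgeSum {n} (λ _ → 0ℚ)) ⟩
    0ℚ                              ∎
    where open ≡-Reasoning

  ⟨⟩-single : ∀ {n} (c w : Vect n) e → (∀ f → f ≢ e → c f ≡ 0ℚ) → ⟨ c , w ⟩ ≡ c e * w e
  ⟨⟩-single c w e c≗0 = trans (⟨⟩≡edgeSum c w)
    (edgeSum-single (λ f → c f * w f) e λ f f≢e → trans (cong (_* w f) (c≗0 f f≢e)) (ℚₚ.*-zeroˡ (w f)))

  𝟙 : Bool → ℚ
  𝟙 b = if b then 1ℚ else 0ℚ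

  𝟙-nonneg : ∀ b → 0ℚ ≤ 𝟙 b
  𝟙-nonneg true  = ℚₚ.nonNegative⁻¹ 1ℚ
  𝟙-nonneg false = ℚₚ.≤-refl

  infix 4 _≟ᴱ_
  _≟ᴱ_ : ∀ {n} → DecidableEquality (Edge n)
  _≟ᴱ_ = ≡-dec (≡-dec _≟_ _≟_) λ p q → yes (<-irrelevant p q)

  δ : ∀ {n} → Edge n → Vect n
  δ e f = 𝟙 (does (f ≟ᴱ e))

  δ-diag : ∀ {n} (e : Edge n) → δ e e ≡ 1ℚ
  δ-diag e with e ≟ᴱ e
  ... | yes _   = refl
  ... | no  e≢e = contradiction refl e≢e

  δ-off : ∀ {n} {e f : Edge n} → f ≢ e → δ e f ≡ 0ℚ
  δ-off {e = e} {f} f≢e with f ≟ᴱ e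
  ... | yes f≡e = contradiction f≡e f≢e
  ... | no  _   = refl

  δ-nonneg : ∀ {n} (e : Edge n) → NonNeg (δ e)
  δ-nonneg e f = 𝟙-nonneg (does (f ≟ᴱ e))

  ⟨δ⟩ˡ : ∀ {n} (e : Edge n) w → ⟨ δ e , w ⟩ ≡ w e
  ⟨δ⟩ˡ e w = trans (⟨⟩-single (δ e) w e λ f → δ-off) (trans (cong (_* w e) (δ-diag e)) (ℚₚ.*-identityˡ (w e)))

  edgeBetween : ∀ {n} {u w : Fin n} → u ≢ w → Edge n
  edgeBetween {u = u} {w} u≢w with <-cmp u w
  ... | tri< u<w _   _   = (u , w) , u<w
  ... | tri≈ _   u≡w _   = contradiction u≡w u≢w
  ... | tri> _   _   w<u = (w , u) , w<u

  edgeBetween-sym : ∀ {n} {A : Set} (F : Fin n → Fin n → A) → (∀ u w → F u w ≡ F w u) →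
    ∀ {u w} (u≢w : u ≢ w) → F (proj₁ (proj₁ (edgeBetween u≢w))) (proj₂ (proj₁ (edgeBetween u≢w))) ≡ F u w
  edgeBetween-sym F F-sym {u} {w} u≢w with <-cmp u w
  ... | tri< _ _   _ = refl
  ... | tri≈ _ u≡w _ = contradiction u≡w u≢w
  ... | tri> _ _   _ = F-sym w u

  -- |E(K_{n+1})| = n + |E(K_n)|: the edges at vertex 0, then the edges of K_n shifted by one
  edgeCount : ℕ → ℕ
  edgeCount zero    = 0
  edgeCount (suc n) = n ℕ.+ edgeCount n

  edgeCount≡nC2 : ∀ n → edgeCount n ≡ n C 2
  edgeCount≡nC2 zero    = refl
  edgeCount≡nC2 (suc n) = trans (cong₂ ℕ._+_ (sym (nC1≡n n)) (edgeCount≡nC2 n)) (nCk+nC[k+1]≡[n+1]C[k+1] n 1)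

  indexToEdge : ∀ n → Fin (edgeCount n) → Edge n
  indexToEdge (suc n) x with Fin.splitAt n x
  ... | inj₁ j = (Fin.zero , Fin.suc j) , ℕ.s≤s ℕ.z≤n
  ... | inj₂ y with indexToEdge n y
  ...   | (i , j) , i<j = (Fin.suc i , Fin.suc j) , ℕ.s≤s i<j

  edgeToIndex : ∀ n → Edge n → Fin (edgeCount n)
  edgeToIndex (suc n) ((Fin.zero  , Fin.suc j) , _)         = j Fin.↑ˡ edgeCount n
  edgeToIndex (suc n) ((Fin.suc i , Fin.suc j) , ℕ.s≤s i<j) = n Fin.↑ʳ edgeToIndex n ((i , j) , i<j)

  indexToEdge∘edgeToIndex : ∀ n e → indexToEdge n (edgeToIndex n e) ≡ e
  indexToEdge∘edgeToIndex (suc n) ((Fin.zero , Fin.suc j) , ℕ.s≤s ℕ.z≤n)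
    rewrite splitAt-↑ˡ n j (edgeCount n) = refl
  indexToEdge∘edgeToIndex (suc n) ((Fin.suc i , Fin.suc j) , ℕ.s≤s i<j)
    rewrite splitAt-↑ʳ n (edgeCount n) (edgeToIndex n ((i , j) , i<j))
          | indexToEdge∘edgeToIndex n ((i , j) , i<j) = refl

  edgeToIndex∘indexToEdge : ∀ n x → edgeToIndex n (indexToEdge n x) ≡ x
  edgeToIndex∘indexToEdge (suc n) x with Fin.splitAt n x in eq
  ... | inj₁ j = splitAt⁻¹-↑ˡ eq
  ... | inj₂ y with indexToEdge n y in eq′
  ...   | (i , j) , i<j =
    trans (cong (n Fin.↑ʳ_) (trans (cong (edgeToIndex n) (sym eq′)) (edgeToIndex∘indexToEdge n y)))
          (splitAt⁻¹-↑ʳ eq)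

  edge↔index : ∀ n → Edge n ↔ Fin (n C 2)
  edge↔index n = subst (λ d → Edge n ↔ Fin d) (edgeCount≡nC2 n)
    (mk↔ₛ′ (edgeToIndex n) (indexToEdge n) (edgeToIndex∘indexToEdge n) (indexToEdge∘edgeToIndex n))

  *-zero-cancelʳ : ∀ {x y} → y ≢ 0ℚ → x * y ≡ 0ℚ → x ≡ 0ℚ
  *-zero-cancelʳ {x} {y} y≢0 xy≡0 = begin
    x                  ≡⟨ ℚₚ.*-identityʳ x ⟨
    x * 1ℚ             ≡⟨ cong (x *_) (ℚₚ.*-inverseʳ y) ⟨
    x * (y * 1/ y)     ≡⟨ ℚₚ.*-assoc x y (1/ y) ⟨
    (x * y) * 1/ y     ≡⟨ cong (_* 1/ y) xy≡0 ⟩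
    0ℚ * 1/ y          ≡⟨ ℚₚ.*-zeroˡ (1/ y) ⟩
    0ℚ                 ∎
    where
    open ≡-Reasoning
    instance _ = ℚ.≢-nonZero y≢0

  *-cancelˡ-≢ : ∀ {x y z} → x * y ≡ x * z → y ≢ z → x ≡ 0ℚ
  *-cancelˡ-≢ {x} {y} {z} xy≡xz y≢z = *-zero-cancelʳ y-z≢0 (begin
    x * (y + - z)      ≡⟨ ℚₚ.*-distribˡ-+ x y (- z) ⟩
    x * y + x * - z    ≡⟨ cong (_+ x * - z) xy≡xz ⟩
    x * z + x * - z    ≡⟨ ℚₚ.*-distribˡ-+ x z (- z) ⟨
    x * (z + - z)      ≡⟨ cong (x *_) (ℚₚ.+-inverseʳ z) ⟩
    x * 0ℚ             ≡⟨ ℚₚ.*-zeroʳ x ⟩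
    0ℚ                 ∎)
    where
    open ≡-Reasoning
    y-z≢0 : y + - z ≢ 0ℚ
    y-z≢0 y-z≡0 = y≢z (begin
      y                  ≡⟨ solve 2 (λ y z → y := (y :+ (:- z)) :+ z) refl y z ⟩
      (y + - z) + z      ≡⟨ cong (_+ z) y-z≡0 ⟩
      0ℚ + z             ≡⟨ ℚₚ.+-identityˡ z ⟩
      z                  ∎)

  *-≢0 : ∀ {x y} → x ≢ 0ℚ → y ≢ 0ℚ → x * y ≢ 0ℚ
  *-≢0 x≢0 y≢0 = x≢0 ∘ *-zero-cancelʳ y≢0

  record NontrivialSolution {k m} (A : Fin k → Fin m → ℚ) : Set where
    field
      solution : Fin m → ℚ
      nonzero  : ∃ λ i → solution i ≢ 0ℚ
      solves   : ∀ r → sumFin (λ i → A r i * solution i) ≡ 0ℚ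

  -- Column j is eliminated from the rows below row 0 using the pivot A₀ⱼ; a solution b of the
  -- reduced system extends to the full system by back-substitution.
  module Elimination {k m} (A : Fin (suc k) → Fin (suc m) → ℚ) (j : Fin (suc m)) where
    A₀ = A Fin.zero
    p  = A₀ j

    reduced : Fin k → Fin m → ℚ
    reduced r i = p * A (Fin.suc r) (punchIn j i) + - A (Fin.suc r) j * A₀ (punchIn j i)

    module _ (b : Fin m → ℚ) where
      S₀ = sumFin (λ i → A₀ (punchIn j i) * b i)

      backSubstitute : Fin (suc m) → ℚ
      backSubstitute = insertAt (λ i → p * b i) j (- S₀)

      backSubstitute-nonzero : p ≢ 0ℚ → ∃ (λ i → b i ≢ 0ℚ) → ∃ λ i → backSubstitute i ≢ 0ℚ
      backSubstitute-nonzero p≢0 (i , bᵢ≢0) =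
        punchIn j i , *-≢0 p≢0 bᵢ≢0 ∘ trans (sym (insertAt-punchIn (λ i → p * b i) j (- S₀) i))

      expand : ∀ (R : Fin (suc m) → ℚ) →
        sumFin (λ i → R i * backSubstitute i) ≡ R j * - S₀ + sumFin (λ i → R (punchIn j i) * (p * b i))
      expand R = trans (sumFin-punchIn (λ i → R i * backSubstitute i) j)
        (cong₂ _+_ (cong (R j *_) (insertAt-lookup (λ i → p * b i) j (- S₀)))
                   (sumFin-cong λ i → cong (R (punchIn j i) *_) (insertAt-punchIn (λ i → p * b i) j (- S₀) i)))

      backSubstitute-solves : (∀ r → sumFin (λ i → reduced r i * b i) ≡ 0ℚ) →
        ∀ r → sumFin (λ i → A r i * backSubstitute i) ≡ 0ℚ
      backSubstitute-solves _ Fin.zero = begin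
        sumFin (λ i → A₀ i * backSubstitute i)                    ≡⟨ expand A₀ ⟩
        p * - S₀ + sumFin (λ i → A₀ (punchIn j i) * (p * b i))     ≡⟨ cong (p * - S₀ +_) pullP ⟩
        p * - S₀ + p * S₀                                          ≡⟨ solve 2 (λ x y → x :* (:- y) :+ x :* y := con 0ℚ) refl p S₀ ⟩
        0ℚ                                                         ∎
        where
        open ≡-Reasoning
        pullP : sumFin (λ i → A₀ (punchIn j i) * (p * b i)) ≡ p * S₀
        pullP = trans (sumFin-cong λ i → solve 3 (λ x y z → x :* (y :* z) := y :* (x :* z)) refl (A₀ (punchIn j i)) p (b i))
                      (sumFin-*ˡ p (λ i → A₀ (punchIn j i) * b i))
      backSubstitute-solves solvesReduced (Fin.suc r) = begin
        sumFin (λ i → R i * backSubstitute i)                      ≡⟨ expand R ⟩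
        R j * - S₀ + T                                             ≡⟨ solve 3 (λ x y z → x :* (:- y) :+ z := z :+ (:- x) :* y) refl (R j) S₀ T ⟩
        T + - R j * S₀                                             ≡⟨ cong (T +_) (sumFin-*ˡ (- R j) (λ i → A₀ (punchIn j i) * b i)) ⟨
        T + sumFin (λ i → - R j * (A₀ (punchIn j i) * b i))        ≡⟨ sumFin-+ (λ i → R (punchIn j i) * (p * b i)) _ ⟨
        sumFin (λ i → R (punchIn j i) * (p * b i) + - R j * (A₀ (punchIn j i) * b i))
          ≡⟨ sumFin-cong (λ i → solve 5 (λ u v w x y → u :* (v :* w) :+ (:- x) :* (y :* w) := (v :* u :+ (:- x) :* y) :* w)
                                      refl (R (punchIn j i)) p (b i) (R j) (A₀ (punchIn j i))) ⟩
        sumFin (λ i → reduced r i * b i)                           ≡⟨ solvesReduced r ⟩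
        0ℚ                                                         ∎
        where
        open ≡-Reasoning
        R = A (Fin.suc r)
        T = sumFin (λ i → R (punchIn j i) * (p * b i))

  homogeneous-nontrivial : ∀ {k m} → k ℕ.< m → (A : Fin k → Fin m → ℚ) → NontrivialSolution A
  homogeneous-nontrivial {zero} {suc m} _ A = record { solution = λ _ → 1ℚ ; nonzero = Fin.zero , λ () ; solves = λ () }
  homogeneous-nontrivial {suc k} {suc m} (s≤s k<m) A with any? (λ j → ¬? (A Fin.zero j ℚₚ.≟ 0ℚ))
  ... | yes (j , p≢0) = record
    { solution = backSubstitute solution
    ; nonzero  = backSubstitute-nonzero solution p≢0 nonzero
    ; solves   = backSubstitute-solves solution solves
    }
    where
    open Elimination A j
    open NontrivialSolution (homogeneous-nontrivial k<m reduced)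
  ... | no noPivot = record { solution = solution ; nonzero = nonzero ; solves = solves′ }
    where
    open NontrivialSolution (homogeneous-nontrivial (m<n⇒m<1+n k<m) (λ r → A (Fin.suc r)))
    firstRow≡0 : ∀ j → A Fin.zero j ≡ 0ℚ
    firstRow≡0 j with A Fin.zero j ℚₚ.≟ 0ℚ
    ... | yes A₀ⱼ≡0 = A₀ⱼ≡0
    ... | no  A₀ⱼ≢0 = contradiction (j , A₀ⱼ≢0) noPivot
    solves′ : ∀ r → sumFin (λ i → A r i * solution i) ≡ 0ℚ
    solves′ Fin.zero    = sumFin-zero λ i → trans (cong (_* solution i) (firstRow≡0 i)) (ℚₚ.*-zeroˡ (solution i))
    solves′ (Fin.suc r) = solves r

  determinedBy-fewer⇒¬LinIndep : ∀ {n m k} → k ℕ.< m → (v : Fin m → Vect n) (cov : Fin k → Edge n) →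
    (∀ a → (∀ r → combination a v (cov r) ≡ 0ℚ) → ∀ e → combination a v e ≡ 0ℚ) → ¬ LinIndep v
  determinedBy-fewer⇒¬LinIndep k<m v cov determined indep = aᵢ≢0 (indep a (determined a onCov) i)
    where
    open NontrivialSolution (homogeneous-nontrivial k<m (λ r i → v i (cov r))) renaming (solution to a)
    i = proj₁ nonzero
    aᵢ≢0 = proj₂ nonzero
    onCov : ∀ r → combination a v (cov r) ≡ 0ℚ
    onCov r = trans (sumFin-cong λ i → ℚₚ.*-comm (a i) (v i (cov r))) (solves r)

  module _ {n d} (E : Edge n ↔ Fin (suc d)) (e₀ : Edge n) where
    open Inverse E

    edgesExcept : Fin d → Edge n
    edgesExcept x = from (punchIn (to e₀) x)

    edgesExcept-cover : ∀ {e} → e ≢ e₀ → ∃ λ x → edgesExcept x ≡ e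
    edgesExcept-cover {e} e≢e₀ = punchOut j₀≢j , trans (cong from (punchIn-punchOut j₀≢j)) (strictlyInverseʳ e)
      where
      j₀≢j : to e₀ ≢ to e
      j₀≢j = e≢e₀ ∘ sym ∘ Injection.injective (Inverse⇒Injection E)

    edgesExcept-≢ : ∀ x → edgesExcept x ≢ e₀
    edgesExcept-≢ x eq = punchInᵢ≢i (to e₀) x (trans (sym (strictlyInverseˡ _)) (cong to eq))

    edgesExcept-injective : ∀ {x y} → edgesExcept x ≡ edgesExcept y → x ≡ y
    edgesExcept-injective {x} {y} eq =
      punchIn-injective (to e₀) x y (trans (sym (strictlyInverseˡ _)) (trans (cong to eq) (strictlyInverseˡ _)))

  module _ {n d} (E : Edge n ↔ Fin (suc (suc d))) {e₁ e₂ : Edge n} (e₂≢e₁ : e₂ ≢ e₁) where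

    private
      j = proj₁ (edgesExcept-cover E e₁ e₂≢e₁)

    edgesExcept₂ : Fin d → Edge n
    edgesExcept₂ x = edgesExcept E e₁ (punchIn j x)

    edgesExcept₂-cover : ∀ {e} → e ≢ e₁ → e ≢ e₂ → ∃ λ x → edgesExcept₂ x ≡ e
    edgesExcept₂-cover e≢e₁ e≢e₂ = punchOut j≢y , trans (cong (edgesExcept E e₁) (punchIn-punchOut j≢y)) eq
      where
      y  = proj₁ (edgesExcept-cover E e₁ e≢e₁)
      eq = proj₂ (edgesExcept-cover E e₁ e≢e₁)
      j≢y : j ≢ y
      j≢y j≡y = e≢e₂ (trans (sym eq) (trans (cong (edgesExcept E e₁) (sym j≡y)) (proj₂ (edgesExcept-cover E e₁ e₂≢e₁))))

  combination-zeroAt : ∀ {n m} (a : Fin m → ℚ) (v : Fin m → Vect n) e → (∀ i → v i e ≡ 0ℚ) → combination a v e ≡ 0ℚ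
  combination-zeroAt a v e vᵢₑ≡0 = sumFin-zero λ i → trans (cong (a i *_) (vᵢₑ≡0 i)) (ℚₚ.*-zeroʳ (a i))

  twoZeroCoordinates⇒¬dim≥d∸1 : ∀ {n d} → Edge n ↔ Fin d → {K : Vect n → Set} {e₁ e₂ : Edge n} → e₂ ≢ e₁ →
    (∀ c → K c → c e₁ ≡ 0ℚ × c e₂ ≡ 0ℚ) → ¬ DimAtLeast K (d ∸ 1)
  twoZeroCoordinates⇒¬dim≥d∸1 {d = zero} E {e₁ = e₁} _ _ _ with Inverse.to E e₁
  ... | ()
  twoZeroCoordinates⇒¬dim≥d∸1 {d = suc zero} E {e₁ = e₁} {e₂} e₂≢e₁ _ _ = e₂≢e₁ (Injection.injective (Inverse⇒Injection E) 0≡0)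
    where
    0≡0 : Inverse.to E e₂ ≡ Inverse.to E e₁
    0≡0 with Inverse.to E e₂ | Inverse.to E e₁
    ... | Fin.zero | Fin.zero = refl
  twoZeroCoordinates⇒¬dim≥d∸1 {d = suc (suc d)} E {K} {e₁} {e₂} e₂≢e₁ zeros (v , indep , v∈K) =
    determinedBy-fewer⇒¬LinIndep (n<1+n d) v (edgesExcept₂ E e₂≢e₁) determined indep
    where
    determined : ∀ a → (∀ r → combination a v (edgesExcept₂ E e₂≢e₁ r) ≡ 0ℚ) → ∀ e → combination a v e ≡ 0ℚ
    determined a onCov e with e ≟ᴱ e₁ | e ≟ᴱ e₂
    ... | yes refl | _        = combination-zeroAt a v e λ i → proj₁ (zeros (v i) (v∈K i))
    ... | no _     | yes refl = combination-zeroAt a v e λ i → proj₂ (zeros (v i) (v∈K i))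
    ... | no e≢e₁  | no e≢e₂  = let (x , eq) = edgesExcept₂-cover E e₂≢e₁ e≢e₁ e≢e₂ in
                                subst (λ f → combination a v f ≡ 0ℚ) eq (onCov x)

  hyperplane⇒¬dim>d∸1 : ∀ {n d} → Edge n ↔ Fin d → {K : Vect n → Set} (w₁ w₂ : Vect n) {e₀ : Edge n} →
    w₁ e₀ ≢ w₂ e₀ → (∀ c → K c → ⟨ c , w₁ ⟩ ≡ ⟨ c , w₂ ⟩) → ¬ DimAtLeast K (suc (d ∸ 1))
  hyperplane⇒¬dim>d∸1 {d = zero} E _ _ {e₀} _ _ _ with Inverse.to E e₀
  ... | ()
  hyperplane⇒¬dim>d∸1 {d = suc d} E {K} w₁ w₂ {e₀} w₁≢w₂ onHyperplane (v , indep , v∈K) =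
    determinedBy-fewer⇒¬LinIndep (n<1+n d) v (edgesExcept E e₀) determined indep
    where
    determined : ∀ a → (∀ r → combination a v (edgesExcept E e₀ r) ≡ 0ℚ) → ∀ e → combination a v e ≡ 0ℚ
    determined a onCov = zero-everywhere
      where
      u = combination a v
      zero-off : ∀ f → f ≢ e₀ → u f ≡ 0ℚ
      zero-off f f≢e₀ = let (x , eq) = edgesExcept-cover E e₀ f≢e₀ in subst (λ g → u g ≡ 0ℚ) eq (onCov x)
      ⟨u,w⟩ : ∀ w → ⟨ u , w ⟩ ≡ u e₀ * w e₀
      ⟨u,w⟩ w = ⟨⟩-single u w e₀ zero-off
      same : u e₀ * w₁ e₀ ≡ u e₀ * w₂ e₀
      same = begin
        u e₀ * w₁ e₀                      ≡⟨ ⟨u,w⟩ w₁ ⟨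
        ⟨ u , w₁ ⟩                        ≡⟨ ⟨combination⟩ˡ a v w₁ ⟩
        sumFin (λ i → a i * ⟨ v i , w₁ ⟩) ≡⟨ sumFin-cong (λ i → cong (a i *_) (onHyperplane (v i) (v∈K i))) ⟩
        sumFin (λ i → a i * ⟨ v i , w₂ ⟩) ≡⟨ ⟨combination⟩ˡ a v w₂ ⟨
        ⟨ u , w₂ ⟩                        ≡⟨ ⟨u,w⟩ w₂ ⟩
        u e₀ * w₂ e₀                      ∎
        where open ≡-Reasoning
      zero-everywhere : ∀ e → u e ≡ 0ℚ
      zero-everywhere e with e ≟ᴱ e₀
      ... | yes refl = *-cancelˡ-≢ same w₁≢w₂
      ... | no e≢e₀  = zero-off e e≢e₀

  -- Strong induction on ρ i: at column κ i the only other rows that are nonzero have smaller rank.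
  triangular⇒LinIndep : ∀ {n m} (v : Fin m → Vect n) (κ : Fin m → Edge n) (ρ : Fin m → ℕ) →
    (∀ i → v i (κ i) ≢ 0ℚ) → (∀ i j → j ≢ i → v j (κ i) ≢ 0ℚ → ρ j ℕ.< ρ i) → LinIndep v
  triangular⇒LinIndep v κ ρ diagonal triangular a combination≡0 i = coefficient-zero (suc (ρ i)) i (n<1+n (ρ i))
    where
    coefficient-zero : ∀ bound i → ρ i ℕ.< bound → a i ≡ 0ℚ
    coefficient-zero (suc bound) i (s≤s ρᵢ≤bound) =
      *-zero-cancelʳ (diagonal i) (trans (sym (sumFin-single (λ j → a j * v j (κ i)) i offDiagonal)) (combination≡0 (κ i)))
      where
      offDiagonal : ∀ j → j ≢ i → a j * v j (κ i) ≡ 0ℚ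
      offDiagonal j j≢i with v j (κ i) ℚₚ.≟ 0ℚ
      ... | yes vⱼ≡0 = trans (cong (a j *_) vⱼ≡0) (ℚₚ.*-zeroʳ (a j))
      ... | no  vⱼ≢0 = trans (cong (_* v j (κ i)) (coefficient-zero bound j (<-≤-trans (triangular i j j≢i vⱼ≢0) ρᵢ≤bound)))
                             (ℚₚ.*-zeroˡ (v j (κ i)))

open Vectors

module Cones where
  open import Data.Nat.Combinatorics using (_C_)
  open import Data.Fin.Properties using (all?; ¬∀⟶∃¬)
  open import Data.Fin.Subset.Properties using (∪-∩-booleanAlgebra; x∈p∩q⁻; x∈∁p⇒x∉p; x∉p⇒x∈∁p; x∉∁p⇒x∈p)
  open import Data.Bool.Properties using (not-involutive; ∧-comm; xor-comm; xor-same; ¬-not) renaming (_≟_ to _≟ᵇ_)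
  open import Data.Vec using (lookup)
  open import Data.Vec.Properties using (lookup-map; lookup-zipWith; []=⇒lookup; lookup⇒[]=)
  open import Data.Rational using (ℚ; 0ℚ; 1ℚ; _+_; _*_; _≤_; -_; *≤*)
  open import Data.Integer using (+≤+)
  import Data.Rational.Properties as ℚₚ
  open import Relation.Nullary.Decidable using (dec-true)
  open import Data.Rational.Solver using (module +-*-Solver)
  open +-*-Solver using (solve; _:+_; _:*_; :-_; _:=_; con)

  ∁-involutive : ∀ {n} (S : Subset n) → ∁ (∁ S) ≡ S
  ∁-involutive {n} = ¬-involutive
    where open import Algebra.Lattice.Properties.BooleanAlgebra (∪-∩-booleanAlgebra n) using (¬-involutive)

  lookup-∁ : ∀ {n} (S : Subset n) u → lookup (∁ S) u ≡ not (lookup S u)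
  lookup-∁ S u = lookup-map u not S

  lookup-∁≡ : ∀ {n} (S : Subset n) {u σ} → lookup S u ≡ σ → lookup (∁ S) u ≡ not σ
  lookup-∁≡ S {u} Su = trans (lookup-∁ S u) (cong not Su)

  ∈⇒lookup : ∀ {n} {S : Subset n} {u} → u ∈ S → lookup S u ≡ true
  ∈⇒lookup = []=⇒lookup

  ∉⇒lookup : ∀ {n} {S : Subset n} {u} → u ∉ S → lookup S u ≡ false
  ∉⇒lookup {S = S} {u} u∉S = ¬-not (u∉S ∘ lookup⇒[]= u S)

  ∈∁⇒lookup : ∀ {n} {S : Subset n} {u} → u ∈ ∁ S → lookup S u ≡ false
  ∈∁⇒lookup = ∉⇒lookup ∘ x∈∁p⇒x∉p

  lookup⇒∈ : ∀ {n} {S : Subset n} {u} → lookup S u ≡ true → u ∈ S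
  lookup⇒∈ {S = S} {u} = lookup⇒[]= u S

  not-xor-not : ∀ x y → not x xor not y ≡ x xor y
  not-xor-not false y = not-involutive y
  not-xor-not true  y = refl

  cutVec-∁ : ∀ {n} (S : Subset n) e → cutVec (∁ S) e ≡ cutVec S e
  cutVec-∁ S ((i , j) , _) = cong 𝟙 (trans (cong₂ _xor_ (lookup-∁ S i) (lookup-∁ S j)) (not-xor-not (lookup S i) (lookup S j)))

  cutVec-between : ∀ {n} (S : Subset n) {u w} (u≢w : u ≢ w) → cutVec S (edgeBetween u≢w) ≡ 𝟙 (lookup S u xor lookup S w)
  cutVec-between S = cong 𝟙 ∘ edgeBetween-sym (λ u w → lookup S u xor lookup S w) (λ u w → xor-comm (lookup S u) (lookup S w))

  cutVec-nonneg : ∀ {n} (S : Subset n) → NonNeg (cutVec S)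
  cutVec-nonneg S ((i , j) , _) = 𝟙-nonneg (lookup S i xor lookup S j)

  Kmin-cong : ∀ {n} {X X′ : Subset n} {c} → (∀ e → cutVec X e ≡ cutVec X′ e) → Kmin X c → Kmin X′ c
  Kmin-cong {c = c} X≗X′ (c≥0 , minimal) = c≥0 , λ Y cutY → subst (_≤ ⟨ c , cutVec Y ⟩) (⟨⟩-congʳ c X≗X′) (minimal Y cutY)

  Kmin-∁ : ∀ {n} {X : Subset n} {c} → Kmin X c → Kmin (∁ X) c
  Kmin-∁ {X = X} = Kmin-cong {X = X} {∁ X} (sym ∘ cutVec-∁ X)

  Kmin-∁⁻ : ∀ {n} {X : Subset n} {c} → Kmin (∁ X) c → Kmin X c
  Kmin-∁⁻ {X = X} = Kmin-cong {X = ∁ X} {X} (cutVec-∁ X)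

  SameCut-refl : ∀ {n} {X : Subset n} → SameCut X X
  SameCut-refl = inj₁ refl

  SameCut-∁ : ∀ {n} (X : Subset n) → SameCut X (∁ X)
  SameCut-∁ X = inj₂ (sym (∁-involutive X))

  SameCut-sym : ∀ {n} {X Y : Subset n} → SameCut X Y → SameCut Y X
  SameCut-sym (inj₁ X≡Y)  = inj₁ (sym X≡Y)
  SameCut-sym {Y = Y} (inj₂ X≡∁Y) = inj₂ (trans (sym (∁-involutive Y)) (cong ∁ (sym X≡∁Y)))

  SameCut-trans : ∀ {n} {X Y Z : Subset n} → SameCut X Y → SameCut Y Z → SameCut X Z
  SameCut-trans (inj₁ X≡Y) Y~Z = subst (λ W → SameCut W _) (sym X≡Y) Y~Z
  SameCut-trans (inj₂ X≡∁Y) (inj₁ Y≡Z) = inj₂ (trans X≡∁Y (cong ∁ Y≡Z))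
  SameCut-trans {Z = Z} (inj₂ X≡∁Y) (inj₂ Y≡∁Z) = inj₁ (trans X≡∁Y (trans (cong ∁ Y≡∁Z) (∁-involutive Z)))

  DimEq-cong : ∀ {n} {K K′ : Vect n → Set} {m} → (∀ c → K c → K′ c) → (∀ c → K′ c → K c) → DimEq K m → DimEq K′ m
  DimEq-cong K⊆K′ K′⊆K ((v , indep , v∈K) , notMore) =
    (v , indep , λ i → K⊆K′ (v i) (v∈K i)) ,
    λ (v′ , indep′ , v′∈K′) → notMore (v′ , indep′ , λ i → K′⊆K (v′ i) (v′∈K′ i))

  Adjacent-∁ˡ : ∀ {n} {X Y : Subset n} → Adjacent (∁ X) Y → Adjacent X Y
  Adjacent-∁ˡ {X = X} {Y} (¬∁X~Y , dim) =
    ¬∁X~Y ∘ SameCut-trans (SameCut-sym (SameCut-∁ X)) ,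
    DimEq-cong {K = λ c → Kmin (∁ X) c × Kmin Y c} {K′ = λ c → Kmin X c × Kmin Y c}
               (λ _ (k , k′) → Kmin-∁⁻ {X = X} k , k′) (λ _ (k , k′) → Kmin-∁ {X = X} k , k′) dim

  side : ∀ {n} → Bool → Subset n → Subset n
  side true  S = S
  side false S = ∁ S

  ∈side⇒lookup : ∀ {n} σ {S : Subset n} {u} → u ∈ side σ S → lookup S u ≡ σ
  ∈side⇒lookup true  = ∈⇒lookup
  ∈side⇒lookup false = ∈∁⇒lookup

  SameCut-side : ∀ {n} σ (S : Subset n) → SameCut S (side σ S)
  SameCut-side true  S = SameCut-refl
  SameCut-side false S = SameCut-∁ S

  IsCut-side : ∀ {n} σ {Y : Subset n} → IsCut Y → IsCut (side σ Y)
  IsCut-side true  cutY = cutY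
  IsCut-side false {Y} (Y≢∅ , ∁Y≢∅) = ∁Y≢∅ , subst Nonempty (sym (∁-involutive Y)) Y≢∅

  ∉side⇒∈side-not : ∀ {n} σ {X : Subset n} {u} → u ∉ side σ X → u ∈ side (not σ) X
  ∉side⇒∈side-not true  = x∉p⇒x∈∁p
  ∉side⇒∈side-not false = x∉∁p⇒x∈p

  lookup-∩ : ∀ {n} (X Y : Subset n) u → lookup (X ∩ Y) u ≡ lookup X u ∧ lookup Y u
  lookup-∩ X Y u = lookup-zipWith _∧_ u X Y

  lookup-∪ : ∀ {n} (X Y : Subset n) u → lookup (X ∪ Y) u ≡ lookup X u ∨ lookup Y u
  lookup-∪ X Y u = lookup-zipWith _∨_ u X Y

  -- an edge with endpoints (x , y) and (x′ , y′) (memberships in X and Y) joins X ─ Y to Y ─ X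
  joinsDifferences : Bool → Bool → Bool → Bool → Bool
  joinsDifferences x y x′ y′ = ((x xor y) ∧ (x′ xor y′)) ∧ (x xor x′)

  joinsDifferences-sym : ∀ x y x′ y′ → joinsDifferences x y x′ y′ ≡ joinsDifferences x′ y′ x y
  joinsDifferences-sym x y x′ y′ = cong₂ _∧_ (∧-comm (x xor y) (x′ xor y′)) (xor-comm x x′)

  differenceEdges : ∀ {n} → Subset n → Subset n → Vect n
  differenceEdges X Y ((i , j) , _) = 𝟙 (joinsDifferences (lookup X i) (lookup Y i) (lookup X j) (lookup Y j))

  uncrossing-identity : ∀ x y x′ y′ → let w = 𝟙 (joinsDifferences x y x′ y′) in
    𝟙 (x xor x′) + 𝟙 (y xor y′) ≡ (𝟙 ((x ∧ y) xor (x′ ∧ y′)) + 𝟙 ((x ∨ y) xor (x′ ∨ y′))) + (w + w)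
  uncrossing-identity true  true  true  true  = refl
  uncrossing-identity true  true  true  false = refl
  uncrossing-identity true  true  false true  = refl
  uncrossing-identity true  true  false false = refl
  uncrossing-identity true  false true  true  = refl
  uncrossing-identity true  false true  false = refl
  uncrossing-identity true  false false true  = refl
  uncrossing-identity true  false false false = refl
  uncrossing-identity false true  true  true  = refl
  uncrossing-identity false true  true  false = refl
  uncrossing-identity false true  false true  = refl
  uncrossing-identity false true  false false = refl
  uncrossing-identity false false true  true  = refl
  uncrossing-identity false false true  false = refl
  uncrossing-identity false false false true  = refl
  uncrossing-identity false false false false = refl

  excess≤0 : ∀ {a b c d w : ℚ} → a + b ≡ (c + d) + (w + w) → a ≤ c → b ≤ d → 0ℚ ≤ w → w ≤ 0ℚ
  excess≤0 {a} {b} {c} {d} {w} a+b≡ a≤c b≤d w≥0 = ℚₚ.≤-trans (≤-+ʳ w≥0) 2w≤0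
    where
    s = c + d
    s+2w≤s : s + (w + w) ≤ s
    s+2w≤s = subst (_≤ s) a+b≡ (ℚₚ.+-mono-≤ a≤c b≤d)
    2w≤0 : w + w ≤ 0ℚ
    2w≤0 = subst₂ _≤_ (solve 2 (λ s t → (:- s) :+ (s :+ t) := t) refl s (w + w)) (ℚₚ.+-inverseˡ s)
                      (ℚₚ.+-monoʳ-≤ (- s) s+2w≤s)

  -- Minimality of c at X (against X ∩ Y) and at Y (against X ∪ Y) leaves 2⟨c, differenceEdges X Y⟩ ≤ 0.
  uncrossing : ∀ {n} {X Y : Subset n} {c} → IsCut (X ∩ Y) → IsCut (X ∪ Y) → Kmin X c → Kmin Y c →
    ∀ e → differenceEdges X Y e ≡ 1ℚ → c e ≡ 0ℚ
  uncrossing {X = X} {Y} {c} cut∩ cut∪ (c≥0 , minX) (_ , minY) e W≡1 =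
    ℚₚ.≤-antisym (ℚₚ.≤-trans cₑ≤⟨c,W⟩ ⟨c,W⟩≤0) (c≥0 e)
    where
    W = differenceEdges X Y
    edgewise : ∀ f → (cutVec X ⊕ cutVec Y) f ≡ ((cutVec (X ∩ Y) ⊕ cutVec (X ∪ Y)) ⊕ (W ⊕ W)) f
    edgewise ((i , j) , _) rewrite lookup-∩ X Y i | lookup-∩ X Y j | lookup-∪ X Y i | lookup-∪ X Y j =
      uncrossing-identity (lookup X i) (lookup Y i) (lookup X j) (lookup Y j)
    ⟨c,⟩ : ∀ v w → ⟨ c , v ⊕ w ⟩ ≡ ⟨ c , v ⟩ + ⟨ c , w ⟩
    ⟨c,⟩ = ⟨⊕⟩ʳ c
    split : ⟨ c , cutVec X ⟩ + ⟨ c , cutVec Y ⟩ ≡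
            (⟨ c , cutVec (X ∩ Y) ⟩ + ⟨ c , cutVec (X ∪ Y) ⟩) + (⟨ c , W ⟩ + ⟨ c , W ⟩)
    split = begin
      ⟨ c , cutVec X ⟩ + ⟨ c , cutVec Y ⟩                             ≡⟨ ⟨c,⟩ (cutVec X) (cutVec Y) ⟨
      ⟨ c , cutVec X ⊕ cutVec Y ⟩                                     ≡⟨ ⟨⟩-congʳ c edgewise ⟩
      ⟨ c , (cutVec (X ∩ Y) ⊕ cutVec (X ∪ Y)) ⊕ (W ⊕ W) ⟩             ≡⟨ ⟨c,⟩ _ (W ⊕ W) ⟩
      ⟨ c , cutVec (X ∩ Y) ⊕ cutVec (X ∪ Y) ⟩ + ⟨ c , W ⊕ W ⟩         ≡⟨ cong₂ _+_ (⟨c,⟩ (cutVec (X ∩ Y)) (cutVec (X ∪ Y))) (⟨c,⟩ W W) ⟩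
      (⟨ c , cutVec (X ∩ Y) ⟩ + ⟨ c , cutVec (X ∪ Y) ⟩) + (⟨ c , W ⟩ + ⟨ c , W ⟩) ∎
      where open ≡-Reasoning
    W≥0 : NonNeg W
    W≥0 ((i , j) , _) = 𝟙-nonneg (joinsDifferences (lookup X i) (lookup Y i) (lookup X j) (lookup Y j))
    ⟨c,W⟩≤0 : ⟨ c , W ⟩ ≤ 0ℚ
    ⟨c,W⟩≤0 = excess≤0 split (minX (X ∩ Y) cut∩) (minY (X ∪ Y) cut∪) (⟨⟩-nonneg c≥0 W≥0)
    cₑ≤⟨c,W⟩ : c e ≤ ⟨ c , W ⟩
    cₑ≤⟨c,W⟩ = subst (_≤ ⟨ c , W ⟩) (trans (cong (c e *_) W≡1) (ℚₚ.*-identityʳ (c e))) (term≤⟨⟩ c≥0 W≥0 e)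

  cut-from : ∀ {n} (S : Subset n) {u w} → lookup S u ≡ true → lookup S w ≡ false → IsCut S
  cut-from S {u} {w} Su Sw = (u , lookup⇒∈ Su) , (w , lookup⇒∈ (lookup-∁≡ S Sw))

  lookup-∩≡ : ∀ {n} (X Z : Subset n) {u σ τ} → lookup X u ≡ σ → lookup Z u ≡ τ → lookup (X ∩ Z) u ≡ σ ∧ τ
  lookup-∩≡ X Z {u} Xu Zu = trans (lookup-∩ X Z u) (cong₂ _∧_ Xu Zu)

  lookup-∪≡ : ∀ {n} (X Z : Subset n) {u σ τ} → lookup X u ≡ σ → lookup Z u ≡ τ → lookup (X ∪ Z) u ≡ σ ∨ τ
  lookup-∪≡ X Z {u} Xu Zu = trans (lookup-∪ X Z u) (cong₂ _∨_ Xu Zu)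

  differenceEdges-between : ∀ {n} (X Y : Subset n) {u w x y x′ y′} (u≢w : u ≢ w) →
    lookup X u ≡ x → lookup Y u ≡ y → lookup X w ≡ x′ → lookup Y w ≡ y′ →
    differenceEdges X Y (edgeBetween u≢w) ≡ 𝟙 (joinsDifferences x y x′ y′)
  differenceEdges-between X Y u≢w refl refl refl refl = cong 𝟙 (edgeBetween-sym
    (λ u w → joinsDifferences (lookup X u) (lookup Y u) (lookup X w) (lookup Y w))
    (λ u w → joinsDifferences-sym (lookup X u) (lookup Y u) (lookup X w) (lookup Y w)) u≢w)

  -- Uncrossing X with Y and with ∁ Y forces every c in both cones to vanish on two distinct edges.
  crossing⇒¬Adjacent : ∀ {n} {X Y : Subset n} → (∀ σ τ → Nonempty (side σ X ∩ side τ Y)) → ¬ Adjacent X Y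
  crossing⇒¬Adjacent {n} {X} {Y} quadrant (_ , dim≥ , _) =
    twoZeroCoordinates⇒¬dim≥d∸1 (edge↔index n) e₂≢e₁ vanish dim≥
    where
    corner : ∀ σ τ → ∃ λ u → lookup X u ≡ σ × lookup Y u ≡ τ
    corner σ τ = let (u , u∈) = quadrant σ τ ; (u∈X , u∈Y) = x∈p∩q⁻ (side σ X) (side τ Y) u∈ in
                 u , ∈side⇒lookup σ u∈X , ∈side⇒lookup τ u∈Y
    a = proj₁ (corner true true)
    b = proj₁ (corner true false)
    c = proj₁ (corner false true)
    d = proj₁ (corner false false)
    Xa = proj₁ (proj₂ (corner true true)) ; Ya = proj₂ (proj₂ (corner true true))
    Xb = proj₁ (proj₂ (corner true false)) ; Yb = proj₂ (proj₂ (corner true false))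
    Xc = proj₁ (proj₂ (corner false true)) ; Yc = proj₂ (proj₂ (corner false true))
    Xd = proj₁ (proj₂ (corner false false)) ; Yd = proj₂ (proj₂ (corner false false))
    a≢d : a ≢ d
    a≢d a≡d with trans (sym Xa) (trans (cong (lookup X) a≡d) Xd)
    ... | ()
    b≢c : b ≢ c
    b≢c b≡c with trans (sym Xb) (trans (cong (lookup X) b≡c) Xc)
    ... | ()
    e₁ e₂ : Edge n
    e₁ = edgeBetween a≢d
    e₂ = edgeBetween b≢c
    W₁ : differenceEdges X (∁ Y) e₁ ≡ 1ℚ
    W₁ = differenceEdges-between X (∁ Y) a≢d Xa (lookup-∁≡ Y Ya) Xd (lookup-∁≡ Y Yd)
    W₂ : differenceEdges X Y e₂ ≡ 1ℚ
    W₂ = differenceEdges-between X Y b≢c Xb Yb Xc Yc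
    e₂≢e₁ : e₂ ≢ e₁
    e₂≢e₁ e₂≡e₁ with trans (sym W₂) (trans (cong (differenceEdges X Y) e₂≡e₁) (differenceEdges-between X Y a≢d Xa Ya Xd Yd))
    ... | ()
    vanish : ∀ w → Kmin X w × Kmin Y w → w e₁ ≡ 0ℚ × w e₂ ≡ 0ℚ
    vanish w (kX , kY) =
      uncrossing (cut-from (X ∩ ∁ Y) (lookup-∩≡ X (∁ Y) Xb (lookup-∁≡ Y Yb)) (lookup-∩≡ X (∁ Y) Xa (lookup-∁≡ Y Ya)))
                 (cut-from (X ∪ ∁ Y) (lookup-∪≡ X (∁ Y) Xa (lookup-∁≡ Y Ya)) (lookup-∪≡ X (∁ Y) Xc (lookup-∁≡ Y Yc)))
                 kX (Kmin-∁ {X = Y} kY) e₁ W₁ ,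
      uncrossing (cut-from (X ∩ Y) (lookup-∩≡ X Y Xa Ya) (lookup-∩≡ X Y Xd Yd))
                 (cut-from (X ∪ Y) (lookup-∪≡ X Y Xa Ya) (lookup-∪≡ X Y Xd Yd))
                 kX kY e₂ W₂

  data Colour : Set where
    red green blue : Colour

  infix 4 _≟ᶜ_
  _≟ᶜ_ : DecidableEquality Colour
  red   ≟ᶜ red   = yes refl
  red   ≟ᶜ green = no λ ()
  red   ≟ᶜ blue  = no λ ()
  green ≟ᶜ red   = no λ ()
  green ≟ᶜ green = yes refl
  green ≟ᶜ blue  = no λ ()
  blue  ≟ᶜ red   = no λ ()
  blue  ≟ᶜ green = no λ ()
  blue  ≟ᶜ blue  = yes refl

  does-sym : ∀ {A : Set} (_≟_ : DecidableEquality A) x y → does (x ≟ y) ≡ does (y ≟ x)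
  does-sym _≟_ x y with x ≟ y | y ≟ x
  ... | yes _   | yes _   = refl
  ... | no  _   | no  _   = refl
  ... | yes x≡y | no  y≢x = contradiction (sym x≡y) y≢x
  ... | no  x≢y | yes y≡x = contradiction (sym y≡x) x≢y

  xor-cancelˡ : ∀ s x y → (s xor x) xor (s xor y) ≡ x xor y
  xor-cancelˡ false x y = refl
  xor-cancelˡ true  x y = not-xor-not x y

  odd-colour : ∀ (f : Colour → Bool) {x y} → f x ≡ true → f y ≡ false →
    ∃₂ λ t s → ∀ c → f c ≡ s xor does (c ≟ᶜ t)
  odd-colour f {x} {y} fx fy with f red in fr | f green in fg | f blue in fb
  ... | true  | true  | true  = contradiction (trans (sym (allTrue y)) fy) λ ()
    where
    allTrue : ∀ c → f c ≡ true
    allTrue red = fr ; allTrue green = fg ; allTrue blue = fb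
  ... | false | false | false = contradiction (trans (sym (allFalse x)) fx) λ ()
    where
    allFalse : ∀ c → f c ≡ false
    allFalse red = fr ; allFalse green = fg ; allFalse blue = fb
  ... | true  | false | false = red   , false , λ { red → fr ; green → fg ; blue → fb }
  ... | false | true  | false = green , false , λ { red → fr ; green → fg ; blue → fb }
  ... | false | false | true  = blue  , false , λ { red → fr ; green → fg ; blue → fb }
  ... | false | true  | true  = red   , true  , λ { red → fr ; green → fg ; blue → fb }
  ... | true  | false | true  = green , true  , λ { red → fr ; green → fg ; blue → fb }
  ... | true  | true  | false = blue  , true  , λ { red → fr ; green → fg ; blue → fb }

  -- Every vec e lies in the cones of the red and of the green class cut, and the d - 1 vectors
  -- vec e with e ≠ h₀ are triangular with respect to rank.
  module ThreeColouring {n} (col : Fin n → Colour) {r g b : Fin n}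
                        (col-r : col r ≡ red) (col-g : col g ≡ green) (col-b : col b ≡ blue) where

    inClass : Colour → Fin n → Bool
    inClass t u = does (col u ≟ᶜ t)

    classCut : Colour → Vect n
    classCut t ((i , j) , _) = 𝟙 (inClass t i xor inClass t j)

    isMono : Edge n → Bool
    isMono ((i , j) , _) = does (col i ≟ᶜ col j)

    monochromatic : Vect n
    monochromatic e = 𝟙 (isMono e)

    classCut-between : ∀ t {u w s s′} (u≢w : u ≢ w) → col u ≡ s → col w ≡ s′ →
      classCut t (edgeBetween u≢w) ≡ 𝟙 (does (s ≟ᶜ t) xor does (s′ ≟ᶜ t))
    classCut-between t u≢w refl refl = cong 𝟙 (edgeBetween-sym (λ u w → inClass t u xor inClass t w)
                                                               (λ u w → xor-comm (inClass t u) (inClass t w)) u≢w)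

    isMono-between : ∀ {u w s s′} (u≢w : u ≢ w) → col u ≡ s → col w ≡ s′ →
      isMono (edgeBetween u≢w) ≡ does (s ≟ᶜ s′)
    isMono-between u≢w refl refl = edgeBetween-sym (λ u w → does (col u ≟ᶜ col w)) (λ u w → does-sym _≟ᶜ_ (col u) (col w)) u≢w

    classCut-mono : ∀ t e → isMono e ≡ true → classCut t e ≡ 0ℚ
    classCut-mono t ((i , j) , _) mono with col i ≟ᶜ col j
    ... | yes colᵢ≡colⱼ = trans (cong (λ c → 𝟙 (does (c ≟ᶜ t) xor inClass t j)) colᵢ≡colⱼ) (cong 𝟙 (xor-same (inClass t j)))
    ... | no  _         = contradiction mono λ ()

    r≢b : r ≢ b
    r≢b r≡b with trans (sym col-r) (trans (cong col r≡b) col-b)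
    ... | ()

    g≢b : g ≢ b
    g≢b g≡b with trans (sym col-g) (trans (cong col g≡b) col-b)
    ... | ()

    g₀ h₀ : Edge n
    g₀ = edgeBetween r≢b
    h₀ = edgeBetween g≢b

    level : Edge n → ℚ
    level e = classCut red e + classCut green e

    -- δ e, corrected by multiples of δ g₀ and δ h₀ so that it takes the same value level e on the
    -- red and on the green class cut, plus weight level e on monochromatic edges so that cuts
    -- splitting a colour class are not cheaper.
    vec : Edge n → Vect n
    vec e = δ e ⊕ level e ∙ monochromatic ⊕ classCut green e ∙ δ g₀ ⊕ classCut red e ∙ δ h₀

    ⟨vec⟩ : ∀ e w → ⟨ vec e , w ⟩ ≡ w e + level e * ⟨ monochromatic , w ⟩ + classCut green e * w g₀ + classCut red e * w h₀
    ⟨vec⟩ e w =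
      trans (⟨⊕⟩ˡ _ _ w) (cong₂ _+_
        (trans (⟨⊕⟩ˡ _ _ w) (cong₂ _+_
          (trans (⟨⊕⟩ˡ _ _ w) (cong₂ _+_ (⟨δ⟩ˡ e w) (⟨∙⟩ˡ (level e) monochromatic w)))
          (⟨q∙δ⟩ g₀ (classCut green e))))
        (⟨q∙δ⟩ h₀ (classCut red e)))
      where
      ⟨q∙δ⟩ : ∀ f q → ⟨ q ∙ δ f , w ⟩ ≡ q * w f
      ⟨q∙δ⟩ f q = trans (⟨∙⟩ˡ q (δ f) w) (cong (q *_) (⟨δ⟩ˡ f w))

    ⟨mono,classCut⟩ : ∀ t → ⟨ monochromatic , classCut t ⟩ ≡ 0ℚ
    ⟨mono,classCut⟩ t = ⟨⟩-zero monochromatic (classCut t) vanish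
      where
      vanish : ∀ f → monochromatic f * classCut t f ≡ 0ℚ
      vanish f with isMono f in mono
      ... | true  = trans (cong (1ℚ *_) (classCut-mono t f mono)) (ℚₚ.*-zeroʳ 1ℚ)
      ... | false = ℚₚ.*-zeroˡ (classCut t f)

    ⟨vec,classCut⟩ : ∀ t e → ⟨ vec e , classCut t ⟩ ≡
      classCut t e + level e * 0ℚ + classCut green e * 𝟙 (does (red ≟ᶜ t) xor does (blue ≟ᶜ t))
                                  + classCut red e * 𝟙 (does (green ≟ᶜ t) xor does (blue ≟ᶜ t))
    ⟨vec,classCut⟩ t e = begin
      ⟨ vec e , classCut t ⟩
        ≡⟨ ⟨vec⟩ e (classCut t) ⟩
      classCut t e + level e * ⟨ monochromatic , classCut t ⟩ + cG * classCut t g₀ + cR * classCut t h₀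
        ≡⟨ cong₂ (λ z x → classCut t e + level e * z + cG * x + cR * classCut t h₀)
                 (⟨mono,classCut⟩ t) (classCut-between t r≢b col-r col-b) ⟩
      classCut t e + level e * 0ℚ + cG * 𝟙 (does (red ≟ᶜ t) xor does (blue ≟ᶜ t)) + cR * classCut t h₀
        ≡⟨ cong (λ y → classCut t e + level e * 0ℚ + cG * 𝟙 (does (red ≟ᶜ t) xor does (blue ≟ᶜ t)) + cR * y)
                (classCut-between t g≢b col-g col-b) ⟩
      classCut t e + level e * 0ℚ + cG * 𝟙 (does (red ≟ᶜ t) xor does (blue ≟ᶜ t))
                                  + cR * 𝟙 (does (green ≟ᶜ t) xor does (blue ≟ᶜ t)) ∎
      where
      open ≡-Reasoning
      cG = classCut green e
      cR = classCut red e

    ⟨vec,red⟩ : ∀ e → ⟨ vec e , classCut red ⟩ ≡ level e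
    ⟨vec,red⟩ e = trans (⟨vec,classCut⟩ red e)
      (solve 2 (λ x y → x :+ (x :+ y) :* con 0ℚ :+ y :* con 1ℚ :+ x :* con 0ℚ := x :+ y) refl (classCut red e) (classCut green e))

    ⟨vec,green⟩ : ∀ e → ⟨ vec e , classCut green ⟩ ≡ level e
    ⟨vec,green⟩ e = trans (⟨vec,classCut⟩ green e)
      (solve 2 (λ x y → y :+ (x :+ y) :* con 0ℚ :+ y :* con 0ℚ :+ x :* con 1ℚ := x :+ y) refl (classCut red e) (classCut green e))

    ⟨vec,blue⟩ : ∀ e → ⟨ vec e , classCut blue ⟩ ≡ classCut blue e + level e
    ⟨vec,blue⟩ e = trans (⟨vec,classCut⟩ blue e)
      (solve 3 (λ x y z → z :+ (x :+ y) :* con 0ℚ :+ y :* con 1ℚ :+ x :* con 1ℚ := z :+ (x :+ y)) refl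
             (classCut red e) (classCut green e) (classCut blue e))

    classCut-nonneg : ∀ t → NonNeg (classCut t)
    classCut-nonneg t ((i , j) , _) = 𝟙-nonneg (inClass t i xor inClass t j)

    level-nonneg : ∀ e → 0ℚ ≤ level e
    level-nonneg e = +-nonneg (classCut-nonneg red e) (classCut-nonneg green e)

    monochromatic-nonneg : NonNeg monochromatic
    monochromatic-nonneg f = 𝟙-nonneg (isMono f)

    vec-nonneg : ∀ e → NonNeg (vec e)
    vec-nonneg e f =
      +-nonneg (+-nonneg (+-nonneg (δ-nonneg e f) (*-nonneg (level-nonneg e) (monochromatic-nonneg f)))
                         (*-nonneg (classCut-nonneg green e) (δ-nonneg g₀ f)))
               (*-nonneg (classCut-nonneg red e) (δ-nonneg h₀ f))

    δ≤vec : ∀ e f → δ e f ≤ vec e f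
    δ≤vec e f = ℚₚ.≤-trans (ℚₚ.≤-trans
      (≤-+ʳ (*-nonneg (level-nonneg e) (monochromatic-nonneg f)))
      (≤-+ʳ (*-nonneg (classCut-nonneg green e) (δ-nonneg g₀ f))))
      (≤-+ʳ (*-nonneg (classCut-nonneg red e) (δ-nonneg h₀ f)))

    level≤vec : ∀ e f → isMono f ≡ true → level e ≤ vec e f
    level≤vec e f mono = subst (_≤ vec e f) (trans (cong (level e *_) (cong 𝟙 mono)) (ℚₚ.*-identityʳ (level e)))
      (ℚₚ.≤-trans (ℚₚ.≤-trans
        (≤-+ˡ (δ-nonneg e f))
        (≤-+ʳ (*-nonneg (classCut-nonneg green e) (δ-nonneg g₀ f))))
        (≤-+ʳ (*-nonneg (classCut-nonneg red e) (δ-nonneg h₀ f))))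

    level≤⟨vec,classCut⟩ : ∀ t e → level e ≤ ⟨ vec e , classCut t ⟩
    level≤⟨vec,classCut⟩ red   e = ℚₚ.≤-reflexive (sym (⟨vec,red⟩ e))
    level≤⟨vec,classCut⟩ green e = ℚₚ.≤-reflexive (sym (⟨vec,green⟩ e))
    level≤⟨vec,classCut⟩ blue  e = subst (level e ≤_) (sym (⟨vec,blue⟩ e)) (≤-+ˡ (classCut-nonneg blue e))

    rep : Colour → Fin n
    rep red   = r
    rep green = g
    rep blue  = b

    col-rep : ∀ t → col (rep t) ≡ t
    col-rep red   = col-r
    col-rep green = col-g
    col-rep blue  = col-b

    -- A cut that is a union of colour classes is one of the three class cuts; any other cut
    -- separates two vertices of one colour class and pays level e on the edge between them.
    level≤⟨vec,cut⟩ : ∀ e Z → IsCut Z → level e ≤ ⟨ vec e , cutVec Z ⟩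
    level≤⟨vec,cut⟩ e Z ((u₁ , u₁∈Z) , (u₀ , u₀∈∁Z)) with all? (λ u → lookup Z u ≟ᵇ lookup Z (rep (col u)))
    ... | yes unionOfClasses = subst (level e ≤_) (sym (⟨⟩-congʳ (vec e) Z≗class)) (level≤⟨vec,classCut⟩ t e)
      where
      f : Colour → Bool
      f c = lookup Z (rep c)
      odd = odd-colour f (trans (sym (unionOfClasses u₁)) (∈⇒lookup u₁∈Z)) (trans (sym (unionOfClasses u₀)) (∈∁⇒lookup u₀∈∁Z))
      t = proj₁ odd
      s = proj₁ (proj₂ odd)
      Z≡ : ∀ u → lookup Z u ≡ s xor inClass t u
      Z≡ u = trans (unionOfClasses u) (proj₂ (proj₂ odd) (col u))
      Z≗class : ∀ f → cutVec Z f ≡ classCut t f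
      Z≗class ((i , j) , _) = cong 𝟙 (trans (cong₂ _xor_ (Z≡ i) (Z≡ j)) (xor-cancelˡ s (inClass t i) (inClass t j)))
    ... | no notUnion = begin
      level e                         ≤⟨ level≤vec e f f-mono ⟩
      vec e f                         ≡⟨ ℚₚ.*-identityʳ (vec e f) ⟨
      vec e f * 1ℚ                    ≡⟨ cong (vec e f *_) f-cut ⟨
      vec e f * cutVec Z f            ≤⟨ term≤⟨⟩ (vec-nonneg e) (cutVec-nonneg Z) f ⟩
      ⟨ vec e , cutVec Z ⟩            ∎
      where
      open ℚₚ.≤-Reasoning
      split = ¬∀⟶∃¬ n _ (λ u → lookup Z u ≟ᵇ lookup Z (rep (col u))) notUnion
      u = proj₁ split
      Zu≢Zw = proj₂ split
      u≢w : u ≢ rep (col u)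
      u≢w = Zu≢Zw ∘ cong (lookup Z)
      f = edgeBetween u≢w
      f-mono : isMono f ≡ true
      f-mono = trans (isMono-between u≢w refl (col-rep (col u))) (dec-true (col u ≟ᶜ col u) refl)
      f-cut : cutVec Z f ≡ 1ℚ
      f-cut = trans (cutVec-between Z u≢w) (cong 𝟙 (≢⇒xor Zu≢Zw))
        where
        ≢⇒xor : ∀ {x y} → x ≢ y → x xor y ≡ true
        ≢⇒xor {false} {false} x≢y = contradiction refl x≢y
        ≢⇒xor {false} {true}  _   = refl
        ≢⇒xor {true}  {false} _   = refl
        ≢⇒xor {true}  {true}  x≢y = contradiction refl x≢y

    vec∈cones : ∀ {X Y} → (∀ f → cutVec X f ≡ classCut red f) → (∀ f → cutVec Y f ≡ classCut green f) →
      ∀ e → Kmin X (vec e) × Kmin Y (vec e)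
    vec∈cones {X} {Y} X≗R Y≗G e = (vec-nonneg e , minimal {X} X≗R (⟨vec,red⟩ e)) , (vec-nonneg e , minimal {Y} Y≗G (⟨vec,green⟩ e))
      where
      minimal : ∀ {W t} → (∀ f → cutVec W f ≡ classCut t f) → ⟨ vec e , classCut t ⟩ ≡ level e →
        ∀ Z → IsCut Z → ⟨ vec e , cutVec W ⟩ ≤ ⟨ vec e , cutVec Z ⟩
      minimal W≗t ⟨vec,t⟩ Z cutZ =
        subst (_≤ ⟨ vec e , cutVec Z ⟩) (sym (trans (⟨⟩-congʳ (vec e) W≗t) ⟨vec,t⟩)) (level≤⟨vec,cut⟩ e Z cutZ)

    vec-diagonal : ∀ e → vec e e ≢ 0ℚ
    vec-diagonal e vₑₑ≡0 with subst (_≤ 0ℚ) (δ-diag e) (subst (δ e e ≤_) vₑₑ≡0 (δ≤vec e e))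
    ... | *≤* (+≤+ ())

    rank : Edge n → ℕ
    rank f with isMono f | f ≟ᴱ g₀
    ... | true  | _     = 2
    ... | false | yes _ = 1
    ... | false | no  _ = 0

    rank-mono : ∀ {f} → isMono f ≡ true → rank f ≡ 2
    rank-mono {f} mono with isMono f
    ... | true = refl

    rank≤1 : ∀ {f} → isMono f ≡ false → rank f ℕ.≤ 1
    rank≤1 {f} notMono with isMono f | f ≟ᴱ g₀
    ... | false | yes _ = s≤s z≤n
    ... | false | no  _ = z≤n

    rank-other : ∀ {f} → isMono f ≡ false → f ≢ g₀ → rank f ≡ 0
    rank-other {f} notMono f≢g₀ with isMono f | f ≟ᴱ g₀
    ... | false | yes f≡g₀ = contradiction f≡g₀ f≢g₀
    ... | false | no  _    = refl

    g₀-mixed : isMono g₀ ≡ false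
    g₀-mixed = isMono-between r≢b col-r col-b

    rank-g₀ : rank g₀ ≡ 1
    rank-g₀ with isMono g₀ in mono | g₀ ≟ᴱ g₀
    ... | true  | _       = contradiction (trans (sym mono) g₀-mixed) λ ()
    ... | false | yes _   = refl
    ... | false | no  g₀≢g₀ = contradiction refl g₀≢g₀

    vec-off : ∀ e f → f ≢ e → f ≢ h₀ → vec e f ≡ level e * monochromatic f + classCut green e * δ g₀ f
    vec-off e f f≢e f≢h₀ rewrite δ-off f≢e | δ-off f≢h₀ =
      solve 3 (λ x y z → con 0ℚ :+ x :+ y :+ z :* con 0ℚ := x :+ y) refl
            (level e * monochromatic f) (classCut green e * δ g₀ f) (classCut red e)

    level-mono : ∀ {e} → isMono e ≡ true → level e ≡ 0ℚ
    level-mono {e} mono = cong₂ _+_ (classCut-mono red e mono) (classCut-mono green e mono)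

    -- vec e is nonzero off its diagonal only on monochromatic edges (weight level e, zero
    -- when e itself is monochromatic) and on g₀ (weight classCut green e): rank decreases.
    vec-triangular : ∀ e f → f ≢ e → f ≢ h₀ → vec e f ≢ 0ℚ → rank e ℕ.< rank f
    vec-triangular e f f≢e f≢h₀ vₑf≢0 = byMono (isMono f) refl
      where
      vₑf≡ = vec-off e f f≢e f≢h₀
      cG = classCut green e
      mixed-if : (isMono e ≡ true → vec e f ≡ 0ℚ) → isMono e ≡ false
      mixed-if mono⇒0 = ¬-not (vₑf≢0 ∘ mono⇒0)
      byMono : ∀ m → isMono f ≡ m → rank e ℕ.< rank f
      byMono true monoF = subst (rank e ℕ.<_) (sym (rank-mono monoF)) (s≤s (rank≤1 (mixed-if mono⇒0)))
        where
        mono⇒0 : isMono e ≡ true → vec e f ≡ 0ℚ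
        mono⇒0 monoE = trans vₑf≡ (trans (cong₂ (λ l x → l * monochromatic f + x * δ g₀ f)
                                                (level-mono {e} monoE) (classCut-mono green e monoE))
                                         (solve 2 (λ x y → con 0ℚ :* x :+ con 0ℚ :* y := con 0ℚ) refl (monochromatic f) (δ g₀ f)))
      byMono false monoF = byEdge (f ≟ᴱ g₀)
        where
        byEdge : Dec (f ≡ g₀) → rank e ℕ.< rank f
        byEdge (no f≢g₀) = contradiction (trans vₑf≡ (trans (cong₂ (λ m x → level e * m + cG * x) (cong 𝟙 monoF) (δ-off f≢g₀))
                                                       (solve 2 (λ x y → x :* con 0ℚ :+ y :* con 0ℚ := con 0ℚ) refl (level e) cG))) vₑf≢0
        byEdge (yes f≡g₀) = subst₂ ℕ._<_ (sym (rank-other (mixed-if mono⇒0) (f≢e ∘ trans f≡g₀ ∘ sym)))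
                                         (sym (trans (cong rank f≡g₀) rank-g₀)) (s≤s z≤n)
          where
          mono⇒0 : isMono e ≡ true → vec e f ≡ 0ℚ
          mono⇒0 monoE = trans vₑf≡ (trans (cong₂ (λ m x → level e * m + x * δ g₀ f) (cong 𝟙 monoF) (classCut-mono green e monoE))
                                           (solve 2 (λ x y → x :* con 0ℚ :+ con 0ℚ :* y := con 0ℚ) refl (level e) (δ g₀ f)))

    vecs-independent : ∀ {d} → Edge n ↔ Fin d → (K : Vect n → Set) → (∀ e → K (vec e)) → DimAtLeast K (d ∸ 1)
    vecs-independent {zero}  E K vec∈K = (λ ()) , (λ _ _ ()) , λ ()
    vecs-independent {suc d} E K vec∈K =
      vec ∘ κ , triangular⇒LinIndep (vec ∘ κ) κ (rank ∘ κ) (vec-diagonal ∘ κ) triangular , vec∈K ∘ κ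
      where
      κ = edgesExcept E h₀
      triangular : ∀ i j → j ≢ i → vec (κ j) (κ i) ≢ 0ℚ → rank (κ j) ℕ.< rank (κ i)
      triangular i j j≢i = vec-triangular (κ j) (κ i) (j≢i ∘ sym ∘ edgesExcept-injective E h₀) (edgesExcept-≢ E h₀ i)

    facet : ∀ {X Y} → IsCut X → IsCut Y → (∀ f → cutVec X f ≡ classCut red f) → (∀ f → cutVec Y f ≡ classCut green f) →
      DimEq (λ c → Kmin X c × Kmin Y c) ((n C 2) ∸ 1)
    facet {X} {Y} cutX cutY X≗R Y≗G =
      vecs-independent (edge↔index n) (λ c → Kmin X c × Kmin Y c) (vec∈cones {X} {Y} X≗R Y≗G) ,
      hyperplane⇒¬dim>d∸1 (edge↔index n) {λ c → Kmin X c × Kmin Y c} (cutVec X) (cutVec Y) {g₀} X≢Y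
        (λ c (kX , kY) → ℚₚ.≤-antisym (proj₂ kX Y cutY) (proj₂ kY X cutX))
      where
      X≢Y : cutVec X g₀ ≢ cutVec Y g₀
      X≢Y X≡Y with trans (sym (trans (X≗R g₀) (classCut-between red r≢b col-r col-b)))
                         (trans X≡Y (trans (Y≗G g₀) (classCut-between green r≢b col-r col-b)))
      ... | ()

  -- Colour ∁ T red, S green and T ─ S blue.
  nested⇒Adjacent : ∀ {n} {S T : Subset n} → Nonempty S → S ⊂ T → Nonempty (∁ T) → Adjacent T S
  nested⇒Adjacent {n} {S} {T} (g , g∈S) (S⊆T , b , b∈T , b∉S) (r , r∈∁T) =
    ¬T~S , facet ((b , b∈T) , (r , r∈∁T)) ((g , g∈S) , (b , x∉p⇒x∈∁p b∉S)) T≗R S≗G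
    where
    colourOf : Bool → Bool → Colour
    colourOf true  _     = green
    colourOf false true  = blue
    colourOf false false = red

    col : Fin n → Colour
    col u = colourOf (lookup S u) (lookup T u)

    col-r : col r ≡ red
    col-r = cong₂ colourOf (∉⇒lookup (λ r∈S → x∈∁p⇒x∉p r∈∁T (S⊆T r∈S))) (∈∁⇒lookup r∈∁T)
    col-g : col g ≡ green
    col-g = cong₂ colourOf (∈⇒lookup g∈S) refl
    col-b : col b ≡ blue
    col-b = cong₂ colourOf (∉⇒lookup b∉S) (∈⇒lookup b∈T)

    open ThreeColouring col col-r col-g col-b using (classCut; inClass; facet)

    T≡notRed : ∀ u → lookup T u ≡ not (inClass red u)
    T≡notRed u = byMembership (lookup S u) (lookup T u) refl refl
      where
      byMembership : ∀ s t → lookup S u ≡ s → lookup T u ≡ t → t ≡ not (does (colourOf s t ≟ᶜ red))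
      byMembership true  true  _  _  = refl
      byMembership true  false Su Tu = contradiction (trans (sym (∈⇒lookup (S⊆T (lookup⇒∈ Su)))) Tu) λ ()
      byMembership false true  _  _  = refl
      byMembership false false _  _  = refl

    S≡green : ∀ u → lookup S u ≡ inClass green u
    S≡green u = byMembership (lookup S u) (lookup T u)
      where
      byMembership : ∀ s t → s ≡ does (colourOf s t ≟ᶜ green)
      byMembership true  _     = refl
      byMembership false true  = refl
      byMembership false false = refl

    T≗R : ∀ f → cutVec T f ≡ classCut red f
    T≗R ((i , j) , _) = cong 𝟙 (trans (cong₂ _xor_ (T≡notRed i) (T≡notRed j)) (not-xor-not (inClass red i) (inClass red j)))

    S≗G : ∀ f → cutVec S f ≡ classCut green f
    S≗G ((i , j) , _) = cong 𝟙 (cong₂ _xor_ (S≡green i) (S≡green j))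

    ¬T~S : ¬ SameCut T S
    ¬T~S (inj₁ T≡S)  = b∉S (subst (b ∈_) T≡S b∈T)
    ¬T~S (inj₂ T≡∁S) = x∈∁p⇒x∉p (subst (g ∈_) T≡∁S (S⊆T g∈S)) g∈S

open Cones

open import Data.Nat using (_+_; _≤_)
open import Data.Nat.Properties using (≤-total; m≤n⇒m⊓n≡m; m≥n⇒m⊓n≡n; m∸[m∸n]≡n; +-comm; m+n∸n≡m)
open import Data.Fin.Properties using (any?)
open import Data.Fin.Subset.Properties
  using (_∈?_; nonempty?; ⊆-antisym; x∈p∩q⁺; x∈∁p⇒x∉p; x∉p⇒x∈∁p; x∉∁p⇒x∈p; ∣∁p∣≡n∸∣p∣; ∣p∣≤n; drop-∷-⊆; out⊆; in⊆in)
open import Data.Bool.Properties using (∨-zeroʳ)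
open import Data.Vec using ([]; _∷_; here; there; tail)
open import Data.List using (List; []; _∷_; _++_; map; length)
open import Data.List.Properties using (length-++; length-map)
open import Data.List.Relation.Unary.All as All using (All; []; _∷_)
import Data.List.Relation.Unary.All.Properties as All
open import Data.List.Relation.Unary.Any as Any using (Any)
open import Data.List.Relation.Unary.AllPairs as AllPairs using (AllPairs; []; _∷_)
import Data.List.Relation.Unary.AllPairs.Properties as AllPairs
open import Data.List.Membership.Propositional using () renaming (_∈_ to _∈ₗ_)
open import Data.List.Membership.Propositional.Properties using (∈-map⁺; ∈-++⁺ˡ; ∈-++⁺ʳ)
open import Relation.Nullary.Decidable using (_×-dec_; decidable-stable)
open import Data.Nat.Solver using (module +-*-Solver)
open +-*-Solver using (solve; _:+_; _:=_; con)

AllPairs-refine : ∀ {A : Set} {P : A → Set} {R S : A → A → Set} → (∀ {a b} → P a → P b → R a b → S a b) →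
  ∀ {xs} → All P xs → AllPairs R xs → AllPairs S xs
AllPairs-refine refine All.[] [] = []
AllPairs-refine refine (pa All.∷ ps) (ra ∷ rs) = All.zipWith (λ (pb , r) → refine pa pb r) (ps , ra) ∷ AllPairs-refine refine ps rs

⊆∧≢⇒proper : ∀ {n} {S T : Subset n} → S ⊆ T → S ≢ T → ∃ λ x → x ∈ T × x ∉ S
⊆∧≢⇒proper {S = S} {T} S⊆T S≢T with any? (λ x → (x ∈? T) ×-dec ¬? (x ∈? S))
... | yes witness = witness
... | no  none    = contradiction (⊆-antisym S⊆T T⊆S) S≢T
  where
  T⊆S : T ⊆ S
  T⊆S {x} x∈T = decidable-stable (x ∈? S) λ x∉S → none (x , x∈T , x∉S)

subsetsOf : ∀ {n} (allowEmpty allowFull : Bool) → Subset n → List (Subset n)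
subsetsOf e f []            = if e ∧ f then [] ∷ [] else []
subsetsOf e f (outside ∷ T) = map (outside ∷_) (subsetsOf e f T)
subsetsOf e f (inside  ∷ T) = map (inside ∷_) (subsetsOf true f T) ++ map (outside ∷_) (subsetsOf e true T)

Listed : ∀ {n} (allowEmpty allowFull : Bool) → Subset n → Subset n → Set
Listed e f T S = S ⊆ T × (e ≡ false → Nonempty S) × (f ≡ false → ∃ λ x → x ∈ T × x ∉ S)

subsetsOf-sound : ∀ {n} e f (T : Subset n) → All (Listed e f T) (subsetsOf e f T)
subsetsOf-sound true  true  []            = ((λ ()) , (λ ()) , (λ ())) ∷ []
subsetsOf-sound true  false []            = []
subsetsOf-sound false true  []            = []
subsetsOf-sound false false []            = []
subsetsOf-sound e     f     (outside ∷ T) = All.map⁺ (All.map listedOut (subsetsOf-sound e f T))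
  where
  listedOut : ∀ {S} → Listed e f T S → Listed e f (outside ∷ T) (outside ∷ S)
  listedOut (S⊆T , nonempty , proper) =
    out⊆ S⊆T , (λ e≡false → let (x , x∈S) = nonempty e≡false in Fin.suc x , there x∈S) ,
    λ f≡false → let (x , x∈T , x∉S) = proper f≡false in Fin.suc x , there x∈T , λ { (there x∈S) → x∉S x∈S }
subsetsOf-sound e     f     (inside ∷ T)  =
  All.++⁺ (All.map⁺ (All.map listedIn (subsetsOf-sound true f T))) (All.map⁺ (All.map listedOut (subsetsOf-sound e true T)))
  where
  listedIn : ∀ {S} → Listed true f T S → Listed e f (inside ∷ T) (inside ∷ S)
  listedIn (S⊆T , _ , proper) =
    in⊆in S⊆T , (λ _ → Fin.zero , here) ,
    λ f≡false → let (x , x∈T , x∉S) = proper f≡false in Fin.suc x , there x∈T , λ { (there x∈S) → x∉S x∈S }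
  listedOut : ∀ {S} → Listed e true T S → Listed e f (inside ∷ T) (outside ∷ S)
  listedOut (S⊆T , nonempty , _) =
    out⊆ S⊆T , (λ e≡false → let (x , x∈S) = nonempty e≡false in Fin.suc x , there x∈S) ,
    λ _ → Fin.zero , here , λ ()

subsetsOf-complete : ∀ {n} e f (T S : Subset n) → Listed e f T S → S ∈ₗ subsetsOf e f T
subsetsOf-complete true  true  []            []            _                      = Any.here refl
subsetsOf-complete false _     []            []            (_ , nonempty , _)     with nonempty refl
... | () , _
subsetsOf-complete true  false []            []            (_ , _ , proper)       with proper refl
... | () , _
subsetsOf-complete e     f     (outside ∷ T) (inside ∷ S)  (S⊆T , _)              with S⊆T here
... | ()
subsetsOf-complete e     f     (outside ∷ T) (outside ∷ S) (S⊆T , nonempty , proper) =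
  ∈-map⁺ (outside ∷_) (subsetsOf-complete e f T S
    (drop-∷-⊆ S⊆T , (λ e≡false → dropNonempty (nonempty e≡false)) , λ f≡false → dropProper (proper f≡false)))
  where
  dropNonempty : Nonempty (outside ∷ S) → Nonempty S
  dropNonempty (Fin.suc x , there x∈S) = x , x∈S
  dropProper : (∃ λ x → x ∈ outside ∷ T × x ∉ outside ∷ S) → ∃ λ x → x ∈ T × x ∉ S
  dropProper (Fin.suc x , there x∈T , x∉S) = x , x∈T , λ x∈S → x∉S (there x∈S)
subsetsOf-complete e     f     (inside ∷ T)  (inside ∷ S)  (S⊆T , _ , proper) =
  ∈-++⁺ˡ (∈-map⁺ (inside ∷_) (subsetsOf-complete true f T S (drop-∷-⊆ S⊆T , (λ ()) , λ f≡false → dropProper (proper f≡false))))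
  where
  dropProper : (∃ λ x → x ∈ inside ∷ T × x ∉ inside ∷ S) → ∃ λ x → x ∈ T × x ∉ S
  dropProper (Fin.zero  , _         , 0∉S) = contradiction here 0∉S
  dropProper (Fin.suc x , there x∈T , x∉S) = x , x∈T , λ x∈S → x∉S (there x∈S)
subsetsOf-complete e     f     (inside ∷ T)  (outside ∷ S) (S⊆T , nonempty , _) =
  ∈-++⁺ʳ (map (inside ∷_) (subsetsOf true f T))
    (∈-map⁺ (outside ∷_) (subsetsOf-complete e true T S (drop-∷-⊆ S⊆T , (λ e≡false → dropNonempty (nonempty e≡false)) , λ ())))
  where
  dropNonempty : Nonempty (outside ∷ S) → Nonempty S
  dropNonempty (Fin.suc x , there x∈S) = x , x∈S

prepend-unique : ∀ {n} {b} {Ss : List (Subset n)} → AllPairs _≢_ Ss → AllPairs _≢_ (map (b ∷_) Ss)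
prepend-unique = AllPairs.map⁺ ∘ AllPairs.map (λ S≢S′ → S≢S′ ∘ cong tail)

subsetsOf-unique : ∀ {n} e f (T : Subset n) → AllPairs _≢_ (subsetsOf e f T)
subsetsOf-unique true  true  []            = [] ∷ []
subsetsOf-unique true  false []            = []
subsetsOf-unique false true  []            = []
subsetsOf-unique false false []            = []
subsetsOf-unique e     f     (outside ∷ T) = prepend-unique (subsetsOf-unique e f T)
subsetsOf-unique e     f     (inside ∷ T)  =
  AllPairs.++⁺ (prepend-unique (subsetsOf-unique true f T)) (prepend-unique (subsetsOf-unique e true T))
               (All.map⁺ (All.tabulate λ _ → All.map⁺ (All.tabulate λ _ ())))

excluded : Bool → ℕ
excluded true  = 0
excluded false = 1

length-subsetsOf : ∀ {n} e f (T : Subset n) → e ∨ f ≡ true ⊎ Nonempty T →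
  length (subsetsOf e f T) + (excluded e + excluded f) ≡ 2 ^ ∣ T ∣
length-subsetsOf true  true  []            _                = refl
length-subsetsOf true  false []            _                = refl
length-subsetsOf false true  []            _                = refl
length-subsetsOf false false []            (inj₂ (() , _))
length-subsetsOf e     f     (outside ∷ T) hyp =
  trans (cong (_+ (excluded e + excluded f)) (length-map (outside ∷_) (subsetsOf e f T)))
        (length-subsetsOf e f T (Sum.map₂ (λ (x , x∈) → dropNonempty x x∈) hyp))
  where
  dropNonempty : ∀ x → x ∈ outside ∷ T → Nonempty T
  dropNonempty (Fin.suc x) (there x∈T) = x , x∈T
length-subsetsOf e     f     (inside ∷ T)  _   = begin
  length (map (inside ∷_) withT ++ map (outside ∷_) withoutT) + (excluded e + excluded f)
    ≡⟨ cong (_+ (excluded e + excluded f)) (trans (length-++ (map (inside ∷_) withT))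
              (cong₂ _+_ (length-map (inside ∷_) withT) (length-map (outside ∷_) withoutT))) ⟩
  (length withT + length withoutT) + (excluded e + excluded f)
    ≡⟨ solve 4 (λ a b x y → (a :+ b) :+ (x :+ y) := (a :+ (con 0 :+ y)) :+ ((b :+ (x :+ con 0)) :+ con 0)) refl
             (length withT) (length withoutT) (excluded e) (excluded f) ⟩
  (length withT + (0 + excluded f)) + ((length withoutT + (excluded e + 0)) + 0)
    ≡⟨ cong₂ (λ p q → p + (q + 0)) (length-subsetsOf true f T (inj₁ refl)) (length-subsetsOf e true T (inj₁ (∨-zeroʳ e))) ⟩
  2 ^ ∣ T ∣ + (2 ^ ∣ T ∣ + 0) ∎
  where
  open ≡-Reasoning
  withT    = subsetsOf true f T
  withoutT = subsetsOf e true T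

properNonemptySubsets : ∀ {n} → Subset n → List (Subset n)
properNonemptySubsets = subsetsOf false false

listed⇒neighbour : ∀ {n} {T S : Subset n} → Nonempty (∁ T) → Listed false false T S → IsCut S × Adjacent T S
listed⇒neighbour ∁T≢∅ (S⊆T , nonempty , proper) =
  (nonempty refl , (let (x , _ , x∉S) = proper refl in x , x∉p⇒x∈∁p x∉S)) ,
  nested⇒Adjacent (nonempty refl) (S⊆T , proper refl) ∁T≢∅

listed-distinct : ∀ {n} {T A B : Subset n} → Nonempty (∁ T) → Listed false false T A → Listed false false T B →
  A ≢ B → ¬ SameCut A B
listed-distinct _ _ _ A≢B (inj₁ A≡B) = A≢B A≡B
listed-distinct (w , w∈∁T) (A⊆T , _) (B⊆T , _) _ (inj₂ A≡∁B) = w∉T (A⊆T (subst (w ∈_) (sym A≡∁B) (x∉p⇒x∈∁p (w∉T ∘ B⊆T))))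
  where w∉T = x∈∁p⇒x∉p w∈∁T

listed-apart : ∀ {n} {X A B : Subset n} → Listed false false X A → Listed false false (∁ X) B → ¬ SameCut A B
listed-apart (A⊆X , nonemptyA , _) (B⊆∁X , _) (inj₁ A≡B) =
  let (a , a∈A) = nonemptyA refl in x∈∁p⇒x∉p (B⊆∁X (subst (a ∈_) A≡B a∈A)) (A⊆X a∈A)
listed-apart (A⊆X , _ , properA) (B⊆∁X , _) (inj₂ A≡∁B) =
  let (u , u∈X , u∉A) = properA refl in u∉A (subst (u ∈_) (sym A≡∁B) (x∉p⇒x∈∁p λ u∈B → x∈∁p⇒x∉p (B⊆∁X u∈B) u∈X))

someQuadrantEmpty : ∀ {n} {X Y : Subset n} → Adjacent X Y → ∃₂ λ σ τ → Empty (side σ X ∩ side τ Y)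
someQuadrantEmpty {X = X} {Y} adjacent
  with nonempty? (X ∩ Y) | nonempty? (X ∩ ∁ Y) | nonempty? (∁ X ∩ Y) | nonempty? (∁ X ∩ ∁ Y)
... | no empty | _        | _        | _        = true  , true  , empty
... | yes _    | no empty | _        | _        = true  , false , empty
... | yes _    | yes _    | no empty | _        = false , true  , empty
... | yes _    | yes _    | yes _    | no empty = false , false , empty
... | yes q₁   | yes q₂   | yes q₃   | yes q₄   = contradiction adjacent (crossing⇒¬Adjacent quadrant)
  where
  quadrant : ∀ σ τ → Nonempty (side σ X ∩ side τ Y)
  quadrant true  true  = q₁
  quadrant true  false = q₂
  quadrant false true  = q₃
  quadrant false false = q₄

-- An adjacent cut has an empty quadrant, so one of its sides is a nonempty proper subset of
-- one of the sides of X.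
adjacent⇒listed : ∀ {n} {X Y : Subset n} → IsCut Y → Adjacent X Y →
  ∃₂ λ σ S → SameCut Y S × Listed false false (side σ X) S
adjacent⇒listed {X = X} {Y} cutY adjacent@(¬X~Y , _) =
  not σ , side τ Y , SameCut-side τ Y , S⊆T , (λ _ → proj₁ (IsCut-side τ cutY)) , λ _ → ⊆∧≢⇒proper S⊆T S≢T
  where
  σ = proj₁ (someQuadrantEmpty adjacent)
  τ = proj₁ (proj₂ (someQuadrantEmpty adjacent))
  empty = proj₂ (proj₂ (someQuadrantEmpty adjacent))
  S⊆T : side τ Y ⊆ side (not σ) X
  S⊆T x∈S = ∉side⇒∈side-not σ λ x∈side → empty (_ , x∈p∩q⁺ (x∈side , x∈S))
  S≢T : side τ Y ≢ side (not σ) X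
  S≢T S≡T = ¬X~Y (SameCut-trans (SameCut-side (not σ) X) (subst (λ T → SameCut T Y) S≡T (SameCut-sym (SameCut-side τ Y))))

neighbours : ∀ {n} → Subset n → List (Subset n)
neighbours X = properNonemptySubsets X ++ properNonemptySubsets (∁ X)

neighbours-correct : ∀ {n} {X : Subset n} → IsCut X → NeighbourList X (neighbours X)
neighbours-correct {X = X} (X≢∅ , ∁X≢∅) = members , distinct , complete
  where
  ∁∁X≢∅ : Nonempty (∁ (∁ X))
  ∁∁X≢∅ = subst Nonempty (sym (∁-involutive X)) X≢∅
  soundX  = subsetsOf-sound false false X
  sound∁X = subsetsOf-sound false false (∁ X)
  members : All (λ Y → IsCut Y × Adjacent X Y) (neighbours X)
  members = All.++⁺ (All.map (listed⇒neighbour ∁X≢∅) soundX)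
                    (All.map (map₂ Adjacent-∁ˡ ∘ listed⇒neighbour ∁∁X≢∅) sound∁X)
  distinct : AllPairs (λ A B → ¬ SameCut A B) (neighbours X)
  distinct = AllPairs.++⁺ (AllPairs-refine (listed-distinct ∁X≢∅) soundX (subsetsOf-unique false false X))
                          (AllPairs-refine (listed-distinct ∁∁X≢∅) sound∁X (subsetsOf-unique false false (∁ X)))
                          (All.map (λ listedA → All.map (listed-apart listedA) sound∁X) soundX)
  complete : ∀ Y → IsCut Y → Adjacent X Y → Any (SameCut Y) (neighbours X)
  complete Y cutY adjacent with adjacent⇒listed cutY adjacent
  ... | true  , S , Y~S , listed = Any.map (λ S≡ → subst (SameCut Y) S≡ Y~S)
    (∈-++⁺ˡ (subsetsOf-complete false false X S listed))
  ... | false , S , Y~S , listed = Any.map (λ S≡ → subst (SameCut Y) S≡ Y~S)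
    (∈-++⁺ʳ (properNonemptySubsets X) (subsetsOf-complete false false (∁ X) S listed))

2^-cutCard : ∀ {n} (X : Subset n) → 2 ^ (n ∸ cutCard X) + 2 ^ cutCard X ≡ 2 ^ ∣ X ∣ + 2 ^ ∣ ∁ X ∣
2^-cutCard {n} X rewrite ∣∁p∣≡n∸∣p∣ X with ≤-total ∣ X ∣ (n ∸ ∣ X ∣)
... | inj₁ k≤n-k rewrite m≤n⇒m⊓n≡m k≤n-k = +-comm (2 ^ (n ∸ ∣ X ∣)) (2 ^ ∣ X ∣)
... | inj₂ n-k≤k rewrite m≥n⇒m⊓n≡n n-k≤k | m∸[m∸n]≡n (∣p∣≤n X) = refl

length-neighbours : ∀ {n} {X : Subset n} → IsCut X → length (neighbours X) ≡ 2 ^ (n ∸ cutCard X) + 2 ^ cutCard X ∸ 4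
length-neighbours {n} {X} (X≢∅ , ∁X≢∅) = begin
  length (neighbours X)                        ≡⟨ length-++ (properNonemptySubsets X) ⟩
  a + b                                        ≡⟨ m+n∸n≡m (a + b) 4 ⟨
  a + b + 4 ∸ 4                                ≡⟨ cong (_∸ 4) (solve 2 (λ a b → a :+ b :+ con 4 := (a :+ con 2) :+ (b :+ con 2)) refl a b) ⟩
  (a + 2) + (b + 2) ∸ 4                        ≡⟨ cong₂ (λ p q → p + q ∸ 4) (length-subsetsOf false false X (inj₂ X≢∅))
                                                                           (length-subsetsOf false false (∁ X) (inj₂ ∁X≢∅)) ⟩
  2 ^ ∣ X ∣ + 2 ^ ∣ ∁ X ∣ ∸ 4                  ≡⟨ cong (_∸ 4) (2^-cutCard X) ⟨
  2 ^ (n ∸ cutCard X) + 2 ^ cutCard X ∸ 4      ∎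
  where
  open ≡-Reasoning
  a = length (properNonemptySubsets X)
  b = length (properNonemptySubsets (∁ X))

-- The hypothesis 2 ≤ n is implied by IsCut X.
theorem6 : (n : ℕ) → 2 ≤ n → (X : Subset n) → IsCut X →
    Degree X ((2 ^ (n ∸ cutCard X)) + (2 ^ cutCard X) ∸ 4)
theorem6 n _ X cutX = neighbours X , neighbours-correct cutX , length-neighbours cutX
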